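{- For every $n\in\mathbb{N}$, $n\ge1$, there is a group isomorphism $$\Gamma_n\Big/\Big\langle[\mathsf{u}^{\uparrow}],[\mathsf{u}^{\leftarrow}],[\mathsf{u}^{\rightarrow}],[\delta_{a_n}],[\delta_{b_n}],[\delta_{c_n}]\Big\rangle\;\cong\;\Gamma^{\uparrow}_{n-1}\oplus\Gamma^{\leftarrow}_{n-1}\oplus\Gamma^{\rightarrow}_{n-1},$$ where $\Gamma^{\uparrow}_{n-1}:=\Gamma_{n-1}/\langle[\delta_{x_{n-1}}],[\delta_{y_{n-1}}]\rangle$, $\Gamma^{\leftarrow}_{n-1}:=\Gamma_{n-1}/\langle[\delta_{y_{n-1}}],[\delta_{z_{n-1}}]\rangle$ and $\Gamma^{\rightarrow}_{n-1}:=\Gamma_{n-1}/\langle[\delta_{z_{n-1}}],[\delta_{x_{n-1}}]\rangle$.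
   Context: Let $\mathcal{G}_0$ be the complete graph on $u_0=(0,0)$, $u_1=(1,0)$, $u_2=\tfrac12(1,\sqrt3)$, let $\psi_i(x)=\tfrac12(x-u_i)+u_i$, $\mathcal{G}_{n}=\bigcup_{i}\psi_i(\mathcal{G}_{n-1})$, and $G_n=2^n\mathcal{G}_n$ (level-$n$ Sierpiński gasket graph), with vertex set $V_n$. With normal boundary conditions, a sink $s$ is added and each of the three corners of $G_n$ is joined to $s$ by two edges, so every vertex of $V_n$ has degree $4$. $\triangle_n$ is the reduced Laplacian (the graph Laplacian of this multigraph with the row and column of $s$ deleted, indexed by $V_n$), and $\Gamma_n:=\mathbb{Z}^{V_n}/\triangle_n\mathbb{Z}^{V_n}$ (isomorphic to the sandpile group of $G_n$ with normal boundary conditions); $[\mathsf{u}]$ is the class of $\mathsf{u}\in\mathbb{Z}^{V_n}$ and $\langle\cdot\rangle$ the subgroup generated. $\delta_v$ is the indicator vector of vertex $v$. For each $m$, $x_m,y_m,z_m$ denote the lower-left, lower-right and top corner vertices of $G_m$. $G_n$ is the union of three copies of $G_{n-1}$ (lower-left, lower-right, upper), pairwise meeting at the junction points $a_n$ (shared by lower-left and upper copies), $b_n$ (shared by lower-right and upper copies), $c_n$ (shared by lower-left and lower-right copies). $\mathsf{u}^{\uparrow}\in\mathbb{Z}^{V_n}$ equals $1$ at the two neighbours of $a_n$ lying in the upper copy and $0$ elsewhere; $\mathsf{u}^{\leftarrow}$ equals $1$ at the two neighbours of $c_n$ in the lower-left copy and $0$ elsewhere; $\mathsf{u}^{\rightarrow}$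 equals $1$ at the two neighbours of $b_n$ in the lower-right copy and $0$ elsewhere. -}

module Defs where

open import Level using (0ℓ)
open import Data.Bool using (Bool; true; false; T; _∧_; _∨_; if_then_else_; not)
open import Data.Nat as ℕ using (ℕ; zero; suc; _∸_; _^_; _≤ᵇ_)
open import Data.Integer as ℤ using (ℤ; +_; _-_; -_)
open import Data.Integer.Properties as ℤP
open import Data.Product using (Σ; _×_; _,_; proj₁)
open import Data.Product.Properties using (≡-dec)
open import Data.List using (List; []; _∷_; _++_; map; filter; mapMaybe; foldr)
open import Data.List.Membership.Propositional using (_∈_)
open import Data.Maybe using (Maybe; just; nothing)
open import Relation.Nullary.Decidable using (yes; no; ⌊_⌋; T?; ¬?)
open import Relation.Binary.PropositionalEquality
  using (_≡_; refl; sym; trans; cong; cong₂; isEquivalence)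
open import Algebra.Bundles using (AbelianGroup)

-- The level-n Sierpinski gasket graph G_n in triangular-lattice
-- coordinates: the point (i , j) ∈ ℕ × ℕ stands for i·(1,0) + j·(1/2,√3/2).

Pt : Set
Pt = ℕ × ℕ

_≟ᵖ_ : (p q : Pt) → Relation.Nullary.Decidable.Dec (p ≡ q)
_≟ᵖ_ = ≡-dec ℕ._≟_ ℕ._≟_
  where import Relation.Nullary.Decidable

_==ᵖ_ : Pt → Pt → Bool
p ==ᵖ q = ⌊ p ≟ᵖ q ⌋

inG : ℕ → Pt → Bool
inG zero    (i , j) = (i ℕ.+ j) ≤ᵇ 1
inG (suc n) (i , j) =
  inG n (i , j)
  ∨ ((2 ^ n ≤ᵇ i) ∧ inG n (i ∸ 2 ^ n , j))
  ∨ ((2 ^ n ≤ᵇ j) ∧ inG n (i , j ∸ 2 ^ n))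

inLowerLeft inLowerRight inUpper : ℕ → Pt → Bool
inLowerLeft  n (i , j) = inG n (i , j)
inLowerRight n (i , j) = (2 ^ n ≤ᵇ i) ∧ inG n (i ∸ 2 ^ n , j)
inUpper      n (i , j) = (2 ^ n ≤ᵇ j) ∧ inG n (i , j ∸ 2 ^ n)

shift : ℕ → ℕ → Pt → Pt
shift a b (i , j) = (i ℕ.+ a , j ℕ.+ b)

corners₀ : List Pt
corners₀ = (0 , 0) ∷ (1 , 0) ∷ (0 , 1) ∷ []

rawNbrs : ℕ → Pt → List Pt
rawNbrs zero p =
  if inG zero p then filter (λ q → ¬? (p ≟ᵖ q)) corners₀ else []
rawNbrs (suc n) (i , j) =
  (if inLowerLeft n (i , j) then rawNbrs n (i , j) else [])
  ++ (if inLowerRight n (i , j)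
        then map (shift (2 ^ n) 0) (rawNbrs n (i ∸ 2 ^ n , j)) else [])
  ++ (if inUpper n (i , j)
        then map (shift 0 (2 ^ n)) (rawNbrs n (i , j ∸ 2 ^ n)) else [])

adj : ℕ → Pt → Pt → Bool
adj n p q = foldr (λ r b → (r ==ᵖ q) ∨ b) false (rawNbrs n p)

Vtx : ℕ → Set
Vtx n = Σ Pt (λ p → T (inG n p))

toV : (n : ℕ) → Pt → Maybe (Vtx n)
toV n p with T? (inG n p)
... | yes t = just (p , t)
... | no  _ = nothing

nbrs : (n : ℕ) → Vtx n → List (Vtx n)
nbrs n v = mapMaybe (toV n) (rawNbrs n (proj₁ v))

sumℤ : List ℤ → ℤ
sumℤ = foldr ℤ._+_ (+ 0)

-- reduced Laplacian with normal boundary conditions: every vertex has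
-- degree 4 (corners get two edges to the sink), sink row/column deleted
Δ : (n : ℕ) → (Vtx n → ℤ) → (Vtx n → ℤ)
Δ n c v = (+ 4) ℤ.* c v - sumℤ (map c (nbrs n v))

δ : (n : ℕ) → Pt → Vtx n → ℤ
δ n p w = if proj₁ w ==ᵖ p then + 1 else + 0

_⊕_ : ∀ {A : Set} → (A → ℤ) → (A → ℤ) → (A → ℤ)
(f ⊕ g) v = f v ℤ.+ g v

⊖_ : ∀ {A : Set} → (A → ℤ) → (A → ℤ)
(⊖ f) v = - f v

data InH (n : ℕ) (gens : List (Vtx n → ℤ)) : (Vtx n → ℤ) → Set where
  lap  : ∀ c → InH n gens (Δ n c)
  gen  : ∀ {g} → g ∈ gens → InH n gens g
  zro  : InH n gens (λ _ → + 0)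
  add  : ∀ {f g} → InH n gens f → InH n gens g → InH n gens (f ⊕ g)
  neg  : ∀ {f} → InH n gens f → InH n gens (⊖ f)
  resp : ∀ {f g} → (∀ v → f v ≡ g v) → InH n gens f → InH n gens g

module _ (n : ℕ) (gens : List (Vtx n → ℤ)) where

  record QRel (x y : Vtx n → ℤ) : Set where
    constructor qrel
    field diff : InH n gens (λ v → x v - y v)

  private
    eqH : ∀ {x y} → (∀ v → x v ≡ y v) → QRel x y
    eqH {x} {y} p = qrel (resp (λ v → sym (trans (cong (λ t → t - y v) (p v)) (ℤP.+-inverseʳ (y v)))) zro)

    symH : ∀ {x y} → QRel x y → QRel y x
    symH {x} {y} (qrel h) = qrel (resp (λ v → trans (ℤP.neg-distrib-+ (x v) (- y v))
                                 (trans (ℤP.+-comm (- x v) (- - y v)) (cong (λ t → t ℤ.+ (- x v)) (ℤP.neg-involutive (y v))))) (neg h))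

    transH : ∀ {x y z} → QRel x y → QRel y z → QRel x z
    transH {x} {y} {z} (qrel h) (qrel k) = qrel (resp (λ v → lem (x v) (y v) (z v)) (add h k))
      where
      lem : ∀ a b c → (a - b) ℤ.+ (b - c) ≡ a - c
      lem a b c = trans (ℤP.+-assoc a (- b) (b - c))
                  (cong (λ t → a ℤ.+ t) (trans (sym (ℤP.+-assoc (- b) b (- c)))
                  (trans (cong (λ t → t ℤ.+ (- c)) (ℤP.+-inverseˡ b)) (ℤP.+-identityˡ (- c)))))

    congH : ∀ {x y u w} → QRel x y → QRel u w → QRel (x ⊕ u) (y ⊕ w)
    congH {x} {y} {u} {w} (qrel h) (qrel k) = qrel (resp (λ v → lem (x v) (y v) (u v) (w v)) (add h k))
      where
      lem : ∀ a b c d → (a - b) ℤ.+ (c - d) ≡ (a ℤ.+ c) - (b ℤ.+ d)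
      lem a b c d = trans (ℤP.+-assoc a (- b) (c - d))
        (trans (cong (λ t → a ℤ.+ t) (trans (sym (ℤP.+-assoc (- b) c (- d)))
               (trans (cong (λ t → t ℤ.+ (- d)) (ℤP.+-comm (- b) c)) (ℤP.+-assoc c (- b) (- d)))))
        (trans (sym (ℤP.+-assoc a c (- b ℤ.+ - d)))
               (cong (λ t → (a ℤ.+ c) ℤ.+ t) (sym (ℤP.neg-distrib-+ b d)))))

    negH : ∀ {x y} → QRel x y → QRel (⊖ x) (⊖ y)
    negH {x} {y} (qrel h) = qrel (resp (λ v → trans (ℤP.neg-distrib-+ (x v) (- y v)) refl) (neg h))

  Quot : AbelianGroup 0ℓ 0ℓ
  Quot = record
    { Carrier = Vtx n → ℤ
    ; _≈_ = QRel
    ; _∙_ = _⊕_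
    ; ε = λ _ → + 0
    ; _⁻¹ = ⊖_
    ; isAbelianGroup = record
      { isGroup = record
        { isMonoid = record
          { isSemigroup = record
            { isMagma = record
              { isEquivalence = record
                { refl = eqH (λ _ → refl) ; sym = symH ; trans = transH }
              ; ∙-cong = congH }
            ; assoc = λ x y z → eqH (λ v → ℤP.+-assoc (x v) (y v) (z v)) }
          ; identity = (λ x → eqH (λ v → ℤP.+-identityˡ (x v)))
                     , (λ x → eqH (λ v → ℤP.+-identityʳ (x v))) }
        ; inverse = (λ x → eqH (λ v → ℤP.+-inverseˡ (x v)))
                  , (λ x → eqH (λ v → ℤP.+-inverseʳ (x v)))
        ; ⁻¹-cong = negH }
      ; comm = λ x y → eqH (λ v → ℤP.+-comm (x v) (y v)) }
    }

Γ : ℕ → AbelianGroup 0ℓ 0ℓ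
Γ n = Quot n []

xc yc zc : ℕ → Pt
xc m = (0 , 0)
yc m = (2 ^ m , 0)
zc m = (0 , 2 ^ m)

Γ↑ Γ← Γ→ : ℕ → AbelianGroup 0ℓ 0ℓ
Γ↑ m = Quot m (δ m (xc m) ∷ δ m (yc m) ∷ [])
Γ← m = Quot m (δ m (yc m) ∷ δ m (zc m) ∷ [])
Γ→ m = Quot m (δ m (zc m) ∷ δ m (xc m) ∷ [])

aJ bJ cJ : ℕ → Pt
aJ m = (0 , 2 ^ m)        -- lower-left ∩ upper
bJ m = (2 ^ m , 2 ^ m)    -- lower-right ∩ upper
cJ m = (2 ^ m , 0)        -- lower-left ∩ lower-right

u↑ u← u→ : (m : ℕ) → Vtx (suc m) → ℤ
u↑ m w = if adj (suc m) (aJ m) (proj₁ w) ∧ inUpper m (proj₁ w) then + 1 else + 0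
u← m w = if adj (suc m) (cJ m) (proj₁ w) ∧ inLowerLeft m (proj₁ w) then + 1 else + 0
u→ m w = if adj (suc m) (bJ m) (proj₁ w) ∧ inLowerRight m (proj₁ w) then + 1 else + 0

ΓQ : ℕ → AbelianGroup 0ℓ 0ℓ
ΓQ m = Quot (suc m)
  (u↑ m ∷ u← m ∷ u→ m ∷ δ (suc m) (aJ m) ∷ δ (suc m) (bJ m) ∷ δ (suc m) (cJ m) ∷ [])

{-# OPTIONS --safe #-}

-- Restricting a vector on V_{m+1} to the three copies of G_m is a homomorphism
-- ℤ^{V_{m+1}} → (ℤ^{V_m})³.  Away from the junctions a, b, c a vertex lies in exactly
-- one copy and has there the same neighbours as in G_m, so Δ_{m+1} restricts to Δ_m up
-- to the two corners of the copy that sit at junctions; u↑ restricts to -Δ_m δ_x on the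
-- upper copy and vanishes on the others away from junctions (likewise u←, u→).  So
-- restriction descends to the quotients.  The inverse glues a triple back, extending by
-- zero off each copy and at the junctions.  That gluing respects the subgroups reduces,
-- by linearity, to gluing Δ_m δ_κ for a corner κ: for one corner of each copy this is -u,
-- and for the other it is the difference of Δ_{m+1} δ_J and the neighbouring copy's term.

module Submission where

open import Defs
open import Function using (_∘_)
open import Data.Bool using (Bool; true; false; T; _∧_; _∨_; if_then_else_)
open import Data.Bool.Properties as BP using ()
open import Data.Unit using (tt)
open import Data.Empty using (⊥-elim)
open import Data.Nat as ℕ using (ℕ; zero; suc; _∸_; _^_; _≤ᵇ_; _≤_)
open import Data.Nat.Properties as ℕP using ()
open import Data.Integer as ℤ using (ℤ; +_; -[1+_]; _-_; -_)
open import Data.Integer.Properties as ℤP using ()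
open import Data.Integer.Solver using (module +-*-Solver)
open import Data.Product using (Σ; _×_; _,_; proj₁; proj₂)
open import Data.Sum using (_⊎_; inj₁; inj₂; map₁; map₂)
open import Data.Maybe using (just; nothing; maybe′)
open import Data.List using (List; []; _∷_; _++_; map; mapMaybe; foldr)
open import Data.List.Properties as LP using ()
open import Data.List.Membership.Propositional using (_∈_)
open import Data.List.Relation.Unary.Any using (here; there)
open import Data.List.Relation.Unary.All as All using (All; []; _∷_)
open import Data.List.Relation.Unary.All.Properties as AllP using ()
open import Relation.Nullary using (¬_; Dec; yes; no)
open import Relation.Nullary.Decidable using (T?; ¬?)
open import Relation.Binary.PropositionalEquality using (_≡_; refl; sym; trans; cong; cong₂; subst; module ≡-Reasoning)
open import Algebra.Bundles using (AbelianGroup)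
open import Algebra.Construct.DirectProduct using (abelianGroup)
open import Algebra.Morphism.Structures using (module GroupMorphisms)
open import Algebra.Properties.CommutativeSemigroup ℕP.+-commutativeSemigroup using (xy∙z≈xz∙y)
open +-*-Solver


T-∨-elim : ∀ x {y} → T (x ∨ y) → T x ⊎ T y
T-∨-elim true  _ = inj₁ tt
T-∨-elim false t = inj₂ t

T-∨ˡ : ∀ {x} y → T x → T (x ∨ y)
T-∨ˡ {true} _ _ = tt

T-∨ʳ : ∀ x {y} → T y → T (x ∨ y)
T-∨ʳ true  _ = tt
T-∨ʳ false t = t

T-∧-elim : ∀ x {y} → T (x ∧ y) → T x × T y
T-∧-elim true t = tt , t

T-∧-intro : ∀ {x y} → T x → T y → T (x ∧ y)
T-∧-intro {true} _ t = t

¬T⇒false : ∀ {b} → ¬ T b → b ≡ false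
¬T⇒false {true}  ¬t = ⊥-elim (¬t tt)
¬T⇒false {false} _  = refl

T⇒true : ∀ {b} → T b → b ≡ true
T⇒true {true} _ = refl

false⇒¬T : ∀ {b} → b ≡ false → ¬ T b
false⇒¬T refl ()

if-T : ∀ {A : Set} {b} {x y : A} → T b → (if b then x else y) ≡ x
if-T {b = true} _ = refl

if-false : ∀ {A : Set} {b} {x y : A} → b ≡ false → (if b then x else y) ≡ y
if-false refl = refl

==ᵖ⇒≡ : ∀ p q → T (p ==ᵖ q) → p ≡ q
==ᵖ⇒≡ p q t with p ≟ᵖ q
... | yes p≡q = p≡q

≡⇒==ᵖ : ∀ {p q} → p ≡ q → T (p ==ᵖ q)
≡⇒==ᵖ {p} refl with p ≟ᵖ p
... | yes _  = tt
... | no p≢p = p≢p refl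

≢⇒==ᵖ-false : ∀ p q → ¬ p ≡ q → (p ==ᵖ q) ≡ false
≢⇒==ᵖ-false p q p≢q = ¬T⇒false (p≢q ∘ ==ᵖ⇒≡ p q)

==ᵖ-injective : (f : Pt → Pt) → (∀ {p q} → f p ≡ f q → p ≡ q) →
                ∀ p q → (f p ==ᵖ f q) ≡ (p ==ᵖ q)
==ᵖ-injective f f-inj p q with f p ≟ᵖ f q | p ≟ᵖ q
... | yes _      | yes _    = refl
... | no _       | no _     = refl
... | yes fp≡fq  | no p≢q   = ⊥-elim (p≢q (f-inj fp≡fq))
... | no fp≢fq   | yes refl = ⊥-elim (fp≢fq refl)


2^m≢0 : ∀ m → ¬ 2 ^ m ≡ 0
2^m≢0 m = ℕ.≢-nonZero⁻¹ (2 ^ m) {{ℕP.m^n≢0 2 m}}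

2^m≤ᵇ0≡false : ∀ m → (2 ^ m ≤ᵇ 0) ≡ false
2^m≤ᵇ0≡false m = ¬T⇒false (2^m≢0 m ∘ ℕP.n≤0⇒n≡0 ∘ ℕP.≤ᵇ⇒≤ (2 ^ m) 0)

2^m+2^m≡2^[1+m] : ∀ m → 2 ^ m ℕ.+ 2 ^ m ≡ 2 ^ suc m
2^m+2^m≡2^[1+m] m = cong (2 ^ m ℕ.+_) (sym (ℕP.+-identityʳ (2 ^ m)))

2^[1+m]∸2^m≡2^m : ∀ m → 2 ^ suc m ∸ 2 ^ m ≡ 2 ^ m
2^[1+m]∸2^m≡2^m m = trans (cong (_∸ 2 ^ m) (sym (2^m+2^m≡2^[1+m] m))) (ℕP.m+n∸m≡n (2 ^ m) (2 ^ m))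

2^m≤2^[1+m] : ∀ m → 2 ^ m ≤ 2 ^ suc m
2^m≤2^[1+m] m = ℕP.m≤m+n (2 ^ m) _

m+n≤o≤m⇒n≡0×m≡o : ∀ m n o → m ℕ.+ n ≤ o → o ≤ m → n ≡ 0 × m ≡ o
m+n≤o≤m⇒n≡0×m≡o m n o m+n≤o o≤m =
    ℕP.n≤0⇒n≡0 (ℕP.+-cancelˡ-≤ m n 0 (subst (m ℕ.+ n ≤_) (sym (ℕP.+-identityʳ m)) (ℕP.≤-trans m+n≤o o≤m)))
  , ℕP.≤-antisym (ℕP.≤-trans (ℕP.m≤m+n m n) m+n≤o) o≤m

inG⇒i+j≤2^m : ∀ m i j → T (inG m (i , j)) → i ℕ.+ j ≤ 2 ^ m
inG⇒i+j≤2^m zero i j t = ℕP.≤ᵇ⇒≤ (i ℕ.+ j) 1 t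
inG⇒i+j≤2^m (suc m) i j t with T-∨-elim (inG m (i , j)) t
... | inj₁ tL = ℕP.≤-trans (inG⇒i+j≤2^m m i j tL) (2^m≤2^[1+m] m)
... | inj₂ t′ with T-∨-elim ((2 ^ m ≤ᵇ i) ∧ inG m (i ∸ 2 ^ m , j)) t′
... | inj₁ tR = let (N≤i , tG) = T-∧-elim (N ≤ᵇ i) tR in begin
  i ℕ.+ j               ≡⟨ cong (ℕ._+ j) (sym (ℕP.m∸n+n≡m (ℕP.≤ᵇ⇒≤ N i N≤i))) ⟩
  i ∸ N ℕ.+ N ℕ.+ j     ≡⟨ xy∙z≈xz∙y (i ∸ N) N j ⟩
  i ∸ N ℕ.+ j ℕ.+ N     ≤⟨ ℕP.+-monoˡ-≤ N (inG⇒i+j≤2^m m (i ∸ N) j tG) ⟩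
  N ℕ.+ N               ≡⟨ 2^m+2^m≡2^[1+m] m ⟩
  2 ^ suc m             ∎
  where N = 2 ^ m; open ℕP.≤-Reasoning
... | inj₂ tU = let (N≤j , tG) = T-∧-elim (N ≤ᵇ j) tU in begin
  i ℕ.+ j               ≡⟨ cong (i ℕ.+_) (sym (ℕP.m∸n+n≡m (ℕP.≤ᵇ⇒≤ N j N≤j))) ⟩
  i ℕ.+ (j ∸ N ℕ.+ N)   ≡⟨ sym (ℕP.+-assoc i (j ∸ N) N) ⟩
  i ℕ.+ (j ∸ N) ℕ.+ N   ≤⟨ ℕP.+-monoˡ-≤ N (inG⇒i+j≤2^m m i (j ∸ N) tG) ⟩
  N ℕ.+ N               ≡⟨ 2^m+2^m≡2^[1+m] m ⟩
  2 ^ suc m             ∎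
  where N = 2 ^ m; open ℕP.≤-Reasoning

inLowerLeft⇒inG : ∀ m p → T (inLowerLeft m p) → T (inG (suc m) p)
inLowerLeft⇒inG m (i , j) = T-∨ˡ _

inLowerRight⇒inG : ∀ m p → T (inLowerRight m p) → T (inG (suc m) p)
inLowerRight⇒inG m (i , j) = T-∨ʳ (inG m (i , j)) ∘ T-∨ˡ _

inUpper⇒inG : ∀ m p → T (inUpper m p) → T (inG (suc m) p)
inUpper⇒inG m (i , j) = T-∨ʳ (inG m (i , j)) ∘ T-∨ʳ ((2 ^ m ≤ᵇ i) ∧ inG m (i ∸ 2 ^ m , j))

inG-xc : ∀ m → T (inG m (xc m))
inG-xc zero    = tt
inG-xc (suc m) = T-∨ˡ _ (inG-xc m)

inG-yc : ∀ m → T (inG m (yc m))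
inLowerRight-yc : ∀ m → T (inLowerRight m (yc (suc m)))
inG-yc zero    = tt
inG-yc (suc m) = inLowerRight⇒inG m _ (inLowerRight-yc m)
inLowerRight-yc m = T-∧-intro (ℕP.≤⇒≤ᵇ (2^m≤2^[1+m] m))
  (subst (λ s → T (inG m (s , 0))) (sym (2^[1+m]∸2^m≡2^m m)) (inG-yc m))

inG-zc : ∀ m → T (inG m (zc m))
inUpper-zc : ∀ m → T (inUpper m (zc (suc m)))
inG-zc zero    = tt
inG-zc (suc m) = inUpper⇒inG m _ (inUpper-zc m)
inUpper-zc m = T-∧-intro (ℕP.≤⇒≤ᵇ (2^m≤2^[1+m] m))
  (subst (λ s → T (inG m (0 , s))) (sym (2^[1+m]∸2^m≡2^m m)) (inG-zc m))

inLowerRight-shift : ∀ m q → T (inG m q) → T (inLowerRight m (shift (2 ^ m) 0 q))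
inLowerRight-shift m (i , j) t = T-∧-intro (ℕP.≤⇒≤ᵇ (ℕP.m≤n+m (2 ^ m) i))
  (subst (λ s → T (inG m s)) (sym (cong₂ _,_ (ℕP.m+n∸n≡m i (2 ^ m)) (ℕP.+-identityʳ j))) t)

inUpper-shift : ∀ m q → T (inG m q) → T (inUpper m (shift 0 (2 ^ m) q))
inUpper-shift m (i , j) t = T-∧-intro (ℕP.≤⇒≤ᵇ (ℕP.m≤n+m (2 ^ m) j))
  (subst (λ s → T (inG m s)) (sym (cong₂ _,_ (ℕP.+-identityʳ i) (ℕP.m+n∸n≡m j (2 ^ m)))) t)

All-if : ∀ {A : Set} {P : A → Set} b {xs : List A} → All P xs → All P (if b then xs else [])
All-if true  ps = ps
All-if false _  = []

rawNbrs-inG : ∀ n p → All (λ q → T (inG n q)) (rawNbrs n p)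
rawNbrs-inG zero    p = All-if (inG zero p) (AllP.filter⁺ (λ q → ¬? (p ≟ᵖ q)) (tt ∷ tt ∷ tt ∷ []))
rawNbrs-inG (suc n) (i , j) = AllP.++⁺ (All-if (inG n (i , j)) (All.map (T-∨ˡ _) (rawNbrs-inG n (i , j))))
  (AllP.++⁺ (All-if (inLowerRight n (i , j))
               (AllP.map⁺ (All.map (λ {q} → inLowerRight⇒inG n _ ∘ inLowerRight-shift n q) (rawNbrs-inG n _))))
            (All-if (inUpper n (i , j))
               (AllP.map⁺ (All.map (λ {q} → inUpper⇒inG n _ ∘ inUpper-shift n q) (rawNbrs-inG n _)))))

rawNbrs-∉ : ∀ n p → ¬ T (inG n p) → rawNbrs n p ≡ []
rawNbrs-∉ zero    p p∉ = if-false (¬T⇒false p∉)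
rawNbrs-∉ (suc n) (i , j) p∉ =
  cong₂ _++_ (if-false {b = inG n (i , j)} (¬T⇒false (p∉ ∘ T-∨ˡ _)))
   (cong₂ _++_ (if-false {b = inLowerRight n (i , j)} (¬T⇒false (p∉ ∘ inLowerRight⇒inG n (i , j))))
               (if-false {b = inUpper n (i , j)} (¬T⇒false (p∉ ∘ inUpper⇒inG n (i , j)))))


-- The three copies of G_m in G_{m+1} and their junctions

isJunction : ℕ → Pt → Bool
isJunction m p = (p ==ᵖ aJ m) ∨ ((p ==ᵖ bJ m) ∨ (p ==ᵖ cJ m))

module _ (m : ℕ) where
  private
    N = 2 ^ m

  isJunction-a : ∀ {p} → p ≡ aJ m → T (isJunction m p)
  isJunction-a refl = T-∨ˡ _ (≡⇒==ᵖ {aJ m} refl)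

  isJunction-b : ∀ {p} → p ≡ bJ m → T (isJunction m p)
  isJunction-b {p} refl = T-∨ʳ (p ==ᵖ aJ m) (T-∨ˡ _ (≡⇒==ᵖ {bJ m} refl))

  isJunction-c : ∀ {p} → p ≡ cJ m → T (isJunction m p)
  isJunction-c {p} refl = T-∨ʳ (p ==ᵖ aJ m) (T-∨ʳ (p ==ᵖ bJ m) (≡⇒==ᵖ {cJ m} refl))

  isJunction⇒ : ∀ p → T (isJunction m p) → p ≡ aJ m ⊎ p ≡ bJ m ⊎ p ≡ cJ m
  isJunction⇒ p t with T-∨-elim (p ==ᵖ aJ m) t
  ... | inj₁ ta = inj₁ (==ᵖ⇒≡ p _ ta)
  ... | inj₂ t′ with T-∨-elim (p ==ᵖ bJ m) t′
  ... | inj₁ tb = inj₂ (inj₁ (==ᵖ⇒≡ p _ tb))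
  ... | inj₂ tc = inj₂ (inj₂ (==ᵖ⇒≡ p _ tc))

  caseJunction : ∀ {P : Set} p → (isJunction m p ≡ false → P) → P ⊎ T (isJunction m p)
  caseJunction p k with isJunction m p
  ... | true  = inj₂ tt
  ... | false = inj₁ (k refl)

  inLowerLeft∧inLowerRight⇒isJunction : ∀ p → T (inLowerLeft m p) → T (inLowerRight m p) → T (isJunction m p)
  inLowerLeft∧inLowerRight⇒isJunction (i , j) tL tR =
    let (N≤i , _) = T-∧-elim (N ≤ᵇ i) tR
        (j≡0 , i≡N) = m+n≤o≤m⇒n≡0×m≡o i j N (inG⇒i+j≤2^m m i j tL) (ℕP.≤ᵇ⇒≤ N i N≤i)
    in isJunction-c (cong₂ _,_ i≡N j≡0)

  inLowerLeft∧inUpper⇒isJunction : ∀ p → T (inLowerLeft m p) → T (inUpper m p) → T (isJunction m p)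
  inLowerLeft∧inUpper⇒isJunction (i , j) tL tU =
    let (N≤j , _) = T-∧-elim (N ≤ᵇ j) tU
        (i≡0 , j≡N) = m+n≤o≤m⇒n≡0×m≡o j i N (subst (_≤ N) (ℕP.+-comm i j) (inG⇒i+j≤2^m m i j tL)) (ℕP.≤ᵇ⇒≤ N j N≤j)
    in isJunction-a (cong₂ _,_ i≡0 j≡N)

  inLowerRight∧inUpper⇒isJunction : ∀ p → T (inLowerRight m p) → T (inUpper m p) → T (isJunction m p)
  inLowerRight∧inUpper⇒isJunction (i , j) tR tU =
    let (N≤i , tG) = T-∧-elim (N ≤ᵇ i) tR
        (N≤j , _) = T-∧-elim (N ≤ᵇ j) tU
        (i∸N≡0 , j≡N) = m+n≤o≤m⇒n≡0×m≡o j (i ∸ N) N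
                          (subst (_≤ N) (ℕP.+-comm (i ∸ N) j) (inG⇒i+j≤2^m m (i ∸ N) j tG)) (ℕP.≤ᵇ⇒≤ N j N≤j)
    in isJunction-b (cong₂ _,_ (ℕP.≤-antisym (ℕP.m∸n≡0⇒m≤n i∸N≡0) (ℕP.≤ᵇ⇒≤ N i N≤i)) j≡N)

  isJunction-upper⇒xc⊎yc : ∀ q → T (inG m q) → T (isJunction m (shift 0 N q)) → q ≡ xc m ⊎ q ≡ yc m
  isJunction-upper⇒xc⊎yc (i , j) _ tJ with isJunction⇒ _ tJ
  ... | inj₁ e        = inj₁ (cong₂ _,_ (trans (sym (ℕP.+-identityʳ i)) (cong proj₁ e)) (ℕP.+-cancelʳ-≡ N j 0 (cong proj₂ e)))
  ... | inj₂ (inj₁ e) = inj₂ (cong₂ _,_ (trans (sym (ℕP.+-identityʳ i)) (cong proj₁ e)) (ℕP.+-cancelʳ-≡ N j 0 (cong proj₂ e)))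
  ... | inj₂ (inj₂ e) = ⊥-elim (2^m≢0 m (ℕP.m+n≡0⇒n≡0 j (cong proj₂ e)))

  isJunction-lowerLeft⇒yc⊎zc : ∀ q → T (inG m q) → T (isJunction m q) → q ≡ yc m ⊎ q ≡ zc m
  isJunction-lowerLeft⇒yc⊎zc (i , j) t tJ with isJunction⇒ _ tJ
  ... | inj₁ e           = inj₂ e
  ... | inj₂ (inj₂ e)    = inj₁ e
  ... | inj₂ (inj₁ refl) = ⊥-elim (2^m≢0 m (proj₁ (m+n≤o≤m⇒n≡0×m≡o N N N (inG⇒i+j≤2^m m N N t) ℕP.≤-refl)))

  isJunction-lowerRight⇒zc⊎xc : ∀ q → T (inG m q) → T (isJunction m (shift N 0 q)) → q ≡ zc m ⊎ q ≡ xc m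
  isJunction-lowerRight⇒zc⊎xc (i , j) _ tJ with isJunction⇒ _ tJ
  ... | inj₁ e        = ⊥-elim (2^m≢0 m (ℕP.m+n≡0⇒n≡0 i (cong proj₁ e)))
  ... | inj₂ (inj₁ e) = inj₁ (cong₂ _,_ (ℕP.+-cancelʳ-≡ N i 0 (cong proj₁ e)) (trans (sym (ℕP.+-identityʳ j)) (cong proj₂ e)))
  ... | inj₂ (inj₂ e) = inj₂ (cong₂ _,_ (ℕP.+-cancelʳ-≡ N i 0 (cong proj₁ e)) (trans (sym (ℕP.+-identityʳ j)) (cong proj₂ e)))

  -- κ₁, κ₂ are the corners of G_m that the copy places at junctions of G_{m+1},
  -- i.e. the corners whose δ's are factored out in Γ↑, Γ←, Γ→.
  record Copy : Set where
    field
      embPt unembPt  : Pt → Pt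
      inCopy         : Pt → Bool
      κ₁ κ₂          : Pt
      inCopy-embPt   : ∀ q → T (inG m q) → T (inCopy (embPt q))
      inCopy⇒inG     : ∀ p → T (inCopy p) → T (inG (suc m) p)
      unembPt-embPt  : ∀ q → unembPt (embPt q) ≡ q
      embPt-unembPt  : ∀ p → T (inCopy p) → embPt (unembPt p) ≡ p
      inG-unembPt    : ∀ p → T (inCopy p) → T (inG m (unembPt p))
      rawNbrs-inCopy : ∀ p → T (inCopy p) → isJunction m p ≡ false →
                       rawNbrs (suc m) p ≡ map embPt (rawNbrs m (unembPt p))
      isJunction⇒κ   : ∀ q → T (inG m q) → T (isJunction m (embPt q)) → q ≡ κ₁ ⊎ q ≡ κ₂
      κ₁-isJunction  : T (isJunction m (embPt κ₁))
      κ₂-isJunction  : T (isJunction m (embPt κ₂))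
      κ₁≢κ₂          : ¬ κ₁ ≡ κ₂

  upperCopy : Copy
  upperCopy = record
    { embPt = shift 0 N ; unembPt = λ p → (proj₁ p , proj₂ p ∸ N) ; inCopy = inUpper m
    ; κ₁ = xc m ; κ₂ = yc m
    ; inCopy-embPt = inUpper-shift m
    ; inCopy⇒inG = inUpper⇒inG m
    ; unembPt-embPt = λ { (i , j) → cong₂ _,_ (ℕP.+-identityʳ i) (ℕP.m+n∸n≡m j N) }
    ; embPt-unembPt = λ { (i , j) t → cong₂ _,_ (ℕP.+-identityʳ i)
                            (ℕP.m∸n+n≡m (ℕP.≤ᵇ⇒≤ N j (proj₁ (T-∧-elim (N ≤ᵇ j) t)))) }
    ; inG-unembPt = λ { (i , j) t → proj₂ (T-∧-elim (N ≤ᵇ j) t) }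
    ; rawNbrs-inCopy = λ { (i , j) t ¬J →
        cong₂ _++_ (if-false {b = inG m (i , j)}
                      (¬T⇒false (λ tL → false⇒¬T ¬J (inLowerLeft∧inUpper⇒isJunction (i , j) tL t))))
         (cong₂ _++_ (if-false {b = inLowerRight m (i , j)}
                        (¬T⇒false (λ tR → false⇒¬T ¬J (inLowerRight∧inUpper⇒isJunction (i , j) tR t))))
                     (if-T {b = inUpper m (i , j)} t)) }
    ; isJunction⇒κ = isJunction-upper⇒xc⊎yc
    ; κ₁-isJunction = isJunction-a refl
    ; κ₂-isJunction = isJunction-b (cong (_, N) (ℕP.+-identityʳ N))
    ; κ₁≢κ₂ = λ e → 2^m≢0 m (sym (cong proj₁ e))
    }

  lowerLeftCopy : Copy
  lowerLeftCopy = record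
    { embPt = λ p → p ; unembPt = λ p → p ; inCopy = inLowerLeft m
    ; κ₁ = yc m ; κ₂ = zc m
    ; inCopy-embPt = λ { (i , j) t → t }
    ; inCopy⇒inG = inLowerLeft⇒inG m
    ; unembPt-embPt = λ _ → refl
    ; embPt-unembPt = λ _ _ → refl
    ; inG-unembPt = λ { (i , j) t → t }
    ; rawNbrs-inCopy = λ { (i , j) t ¬J →
        trans (cong₂ _++_ (if-T {b = inG m (i , j)} t)
         (cong₂ _++_ (if-false {b = inLowerRight m (i , j)}
                        (¬T⇒false (λ tR → false⇒¬T ¬J (inLowerLeft∧inLowerRight⇒isJunction (i , j) t tR))))
                     (if-false {b = inUpper m (i , j)}
                        (¬T⇒false (λ tU → false⇒¬T ¬J (inLowerLeft∧inUpper⇒isJunction (i , j) t tU))))))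
         (trans (LP.++-identityʳ _) (sym (LP.map-id _))) }
    ; isJunction⇒κ = isJunction-lowerLeft⇒yc⊎zc
    ; κ₁-isJunction = isJunction-c refl
    ; κ₂-isJunction = isJunction-a refl
    ; κ₁≢κ₂ = λ e → 2^m≢0 m (cong proj₁ e)
    }

  lowerRightCopy : Copy
  lowerRightCopy = record
    { embPt = shift N 0 ; unembPt = λ p → (proj₁ p ∸ N , proj₂ p) ; inCopy = inLowerRight m
    ; κ₁ = zc m ; κ₂ = xc m
    ; inCopy-embPt = inLowerRight-shift m
    ; inCopy⇒inG = inLowerRight⇒inG m
    ; unembPt-embPt = λ { (i , j) → cong₂ _,_ (ℕP.m+n∸n≡m i N) (ℕP.+-identityʳ j) }
    ; embPt-unembPt = λ { (i , j) t → cong₂ _,_ (ℕP.m∸n+n≡m (ℕP.≤ᵇ⇒≤ N i (proj₁ (T-∧-elim (N ≤ᵇ i) t))))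
                            (ℕP.+-identityʳ j) }
    ; inG-unembPt = λ { (i , j) t → proj₂ (T-∧-elim (N ≤ᵇ i) t) }
    ; rawNbrs-inCopy = λ { (i , j) t ¬J →
        trans (cong₂ _++_ (if-false {b = inG m (i , j)}
                             (¬T⇒false (λ tL → false⇒¬T ¬J (inLowerLeft∧inLowerRight⇒isJunction (i , j) tL t))))
         (cong₂ _++_ (if-T {b = inLowerRight m (i , j)} t)
                     (if-false {b = inUpper m (i , j)}
                        (¬T⇒false (λ tU → false⇒¬T ¬J (inLowerRight∧inUpper⇒isJunction (i , j) t tU))))))
         (LP.++-identityʳ _) }
    ; isJunction⇒κ = isJunction-lowerRight⇒zc⊎xc
    ; κ₁-isJunction = isJunction-b (cong (N ,_) (ℕP.+-identityʳ N))
    ; κ₂-isJunction = isJunction-c refl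
    ; κ₁≢κ₂ = λ e → 2^m≢0 m (cong proj₂ e)
    }


cong-vtx : ∀ {n} (c : Vtx n → ℤ) {v w : Vtx n} → proj₁ v ≡ proj₁ w → c v ≡ c w
cong-vtx {n} c {p , t} {.p , t′} refl = cong (λ s → c (p , s)) (BP.T-irrelevant t t′)

extend : (n : ℕ) → (Vtx n → ℤ) → Pt → ℤ
extend n c p = maybe′ c (+ 0) (toV n p)

toV-inG : ∀ n p (t : T (inG n p)) → toV n p ≡ just (p , t)
toV-inG n p t with T? (inG n p)
... | yes t′ = cong (λ s → just (p , s)) (BP.T-irrelevant t′ t)
... | no ¬t  = ⊥-elim (¬t t)

toV-∉ : ∀ n p → ¬ T (inG n p) → toV n p ≡ nothing
toV-∉ n p ¬t with T? (inG n p)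
... | yes t = ⊥-elim (¬t t)
... | no _  = refl

extend-inG : ∀ n (c : Vtx n → ℤ) p (t : T (inG n p)) → extend n c p ≡ c (p , t)
extend-inG n c p t rewrite toV-inG n p t = refl

extend-∉ : ∀ n (c : Vtx n → ℤ) p → ¬ T (inG n p) → extend n c p ≡ + 0
extend-∉ n c p ¬t rewrite toV-∉ n p ¬t = refl

extend-vtx : ∀ n (c : Vtx n → ℤ) (v : Vtx n) → extend n c (proj₁ v) ≡ c v
extend-vtx n c (p , t) = extend-inG n c p t

extend-map : ∀ n (c : Vtx n → ℤ) (F : ℤ → ℤ) → F (+ 0) ≡ + 0 → ∀ p → extend n (F ∘ c) p ≡ F (extend n c p)
extend-map n c F F0≡0 p with toV n p
... | just _  = refl
... | nothing = sym F0≡0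

extend-⊕ : ∀ n (f g : Vtx n → ℤ) p → extend n (f ⊕ g) p ≡ extend n f p ℤ.+ extend n g p
extend-⊕ n f g p with toV n p
... | just _  = refl
... | nothing = refl

extend-cong : ∀ n {f g : Vtx n → ℤ} → (∀ v → f v ≡ g v) → ∀ p → extend n f p ≡ extend n g p
extend-cong n f≗g p with toV n p
... | just w  = f≗g w
... | nothing = refl

sumℤ-cong : ∀ {A : Set} {f g : A → ℤ} (xs : List A) → (∀ x → f x ≡ g x) → sumℤ (map f xs) ≡ sumℤ (map g xs)
sumℤ-cong []       _   = refl
sumℤ-cong (x ∷ xs) f≗g = cong₂ ℤ._+_ (f≗g x) (sumℤ-cong xs f≗g)

sumℤ-congᴬ : ∀ {A : Set} {P : A → Set} {f g : A → ℤ} {xs : List A} →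
             All P xs → (∀ x → P x → f x ≡ g x) → sumℤ (map f xs) ≡ sumℤ (map g xs)
sumℤ-congᴬ []         _   = refl
sumℤ-congᴬ (px ∷ pxs) f≗g = cong₂ ℤ._+_ (f≗g _ px) (sumℤ-congᴬ pxs f≗g)

sumℤ-⊕ : ∀ {A : Set} (f g : A → ℤ) (xs : List A) → sumℤ (map (f ⊕ g) xs) ≡ sumℤ (map f xs) ℤ.+ sumℤ (map g xs)
sumℤ-⊕ f g []       = refl
sumℤ-⊕ f g (x ∷ xs) = trans (cong (λ s → f x ℤ.+ g x ℤ.+ s) (sumℤ-⊕ f g xs))
  (solve 4 (λ a b c d → a :+ b :+ (c :+ d) := a :+ c :+ (b :+ d)) refl (f x) (g x) _ _)

sumℤ-* : ∀ {A : Set} (k : ℤ) (f : A → ℤ) (xs : List A) → sumℤ (map (λ x → k ℤ.* f x) xs) ≡ k ℤ.* sumℤ (map f xs)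
sumℤ-* k f []       = sym (ℤP.*-zeroʳ k)
sumℤ-* k f (x ∷ xs) = trans (cong (λ s → k ℤ.* f x ℤ.+ s) (sumℤ-* k f xs)) (sym (ℤP.*-distribˡ-+ k (f x) _))

sumℤ-0 : ∀ {A : Set} (xs : List A) → sumℤ (map (λ _ → + 0) xs) ≡ + 0
sumℤ-0 []       = refl
sumℤ-0 (_ ∷ xs) = trans (ℤP.+-identityˡ _) (sumℤ-0 xs)

sumℤ-++ : ∀ {A : Set} (f : A → ℤ) (xs ys : List A) → sumℤ (map f (xs ++ ys)) ≡ sumℤ (map f xs) ℤ.+ sumℤ (map f ys)
sumℤ-++ f []       ys = sym (ℤP.+-identityˡ _)
sumℤ-++ f (x ∷ xs) ys = trans (cong (λ s → f x ℤ.+ s) (sumℤ-++ f xs ys)) (sym (ℤP.+-assoc (f x) _ _))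

sumℤ-map-∘ : ∀ {A B : Set} (f : B → ℤ) (g : A → B) (xs : List A) → sumℤ (map f (map g xs)) ≡ sumℤ (map (f ∘ g) xs)
sumℤ-map-∘ f g []       = refl
sumℤ-map-∘ f g (x ∷ xs) = cong (λ s → f (g x) ℤ.+ s) (sumℤ-map-∘ f g xs)

sumℤ-nbrs : ∀ n (c : Vtx n → ℤ) v → sumℤ (map c (nbrs n v)) ≡ sumℤ (map (extend n c) (rawNbrs n (proj₁ v)))
sumℤ-nbrs n c v = go (rawNbrs n (proj₁ v))
  where
  go : ∀ ps → sumℤ (map c (mapMaybe (toV n) ps)) ≡ sumℤ (map (extend n c) ps)
  go []       = refl
  go (p ∷ ps) with toV n p
  ... | just w  = cong (λ s → c w ℤ.+ s) (go ps)
  ... | nothing = trans (go ps) (sym (ℤP.+-identityˡ _))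

Δ-cong : ∀ n {f g : Vtx n → ℤ} → (∀ v → f v ≡ g v) → ∀ v → Δ n f v ≡ Δ n g v
Δ-cong n f≗g v = cong₂ _-_ (cong (λ s → + 4 ℤ.* s) (f≗g v)) (sumℤ-cong (nbrs n v) f≗g)

Δ-⊕ : ∀ n (f g : Vtx n → ℤ) v → Δ n (f ⊕ g) v ≡ Δ n f v ℤ.+ Δ n g v
Δ-⊕ n f g v = trans (cong (λ s → + 4 ℤ.* (f v ℤ.+ g v) - s) (sumℤ-⊕ f g (nbrs n v)))
  (solve 4 (λ a b x y → con (+ 4) :* (a :+ b) :- (x :+ y) := (con (+ 4) :* a :- x) :+ (con (+ 4) :* b :- y))
     refl (f v) (g v) _ _)

Δ-* : ∀ n (k : ℤ) (f : Vtx n → ℤ) v → Δ n (λ w → k ℤ.* f w) v ≡ k ℤ.* Δ n f v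
Δ-* n k f v = trans (cong (λ s → + 4 ℤ.* (k ℤ.* f v) - s) (sumℤ-* k f (nbrs n v)))
  (solve 3 (λ k a x → con (+ 4) :* (k :* a) :- (k :* x) := k :* (con (+ 4) :* a :- x)) refl k (f v) _)

Δ-0 : ∀ n {f : Vtx n → ℤ} → (∀ v → f v ≡ + 0) → ∀ v → Δ n f v ≡ + 0
Δ-0 n f≗0 v = trans (Δ-cong n f≗0 v) (cong (λ s → + 0 - s) (sumℤ-0 (nbrs n v)))

module _ {n : ℕ} {gens : List (Vtx n → ℤ)} where

  InH-ℕ* : ∀ {g} → InH n gens g → ∀ k → InH n gens (λ v → + k ℤ.* g v)
  InH-ℕ* {g} _  zero    = resp (λ v → sym (ℤP.*-zeroˡ (g v))) zro
  InH-ℕ* {g} hg (suc k) = resp (λ v → sym (ℤP.suc-* (+ k) (g v))) (add hg (InH-ℕ* hg k))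

  InH-* : ∀ {g} → InH n gens g → ∀ k → InH n gens (λ v → k ℤ.* g v)
  InH-* hg (+ k)        = InH-ℕ* hg k
  InH-* {g} hg -[1+ k ] = resp (λ v → ℤP.neg-distribˡ-* (+ suc k) (g v)) (neg (InH-ℕ* hg (suc k)))

  InH-supportedAt : ∀ p {f} → δ n p ∈ gens → (∀ v → f v ≡ + 0 ⊎ proj₁ v ≡ p) → InH n gens f
  InH-supportedAt p {f} δp∈gens supp = resp pointwise (InH-* (gen δp∈gens) (extend n f p))
    where
    pointwise : ∀ v → extend n f p ℤ.* δ n p v ≡ f v
    pointwise v with proj₁ v ≟ᵖ p | supp v
    ... | yes v≡p | _       = trans (ℤP.*-identityʳ _) (trans (cong (extend n f) (sym v≡p)) (extend-vtx n f v))
    ... | no _    | inj₁ fv≡0 = trans (ℤP.*-zeroʳ (extend n f p)) (sym fv≡0)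
    ... | no v≢p  | inj₂ v≡p  = ⊥-elim (v≢p v≡p)

  InH-supportedOn : (ps : List Pt) → All (λ p → δ n p ∈ gens) ps →
                    ∀ {f} → (∀ v → f v ≡ + 0 ⊎ proj₁ v ∈ ps) → InH n gens f
  InH-supportedOn [] [] {f} supp = resp (λ v → zero-off (supp v)) zro
    where zero-off : ∀ {v} → f v ≡ + 0 ⊎ proj₁ v ∈ [] → + 0 ≡ f v
          zero-off (inj₁ fv≡0) = sym fv≡0
  InH-supportedOn (p ∷ ps) (δp∈gens ∷ δps∈gens) {f} supp =
    resp split (add (InH-supportedAt p {fₚ} δp∈gens suppₚ) (InH-supportedOn ps δps∈gens {fᵣ} suppᵣ))
    where
    fₚ fᵣ : Vtx n → ℤ
    fₚ v = if proj₁ v ==ᵖ p then f v else + 0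
    fᵣ v = if proj₁ v ==ᵖ p then + 0 else f v
    split : ∀ v → fₚ v ℤ.+ fᵣ v ≡ f v
    split v with proj₁ v ==ᵖ p
    ... | true  = ℤP.+-identityʳ _
    ... | false = ℤP.+-identityˡ _
    suppₚ : ∀ v → fₚ v ≡ + 0 ⊎ proj₁ v ≡ p
    suppₚ v with proj₁ v ≟ᵖ p
    ... | yes v≡p = inj₂ v≡p
    ... | no _    = inj₁ refl
    suppᵣ : ∀ v → fᵣ v ≡ + 0 ⊎ proj₁ v ∈ ps
    suppᵣ v with proj₁ v ≟ᵖ p | supp v
    ... | yes _   | _                = inj₁ refl
    ... | no _    | inj₁ fv≡0        = inj₁ fv≡0
    ... | no v≢p  | inj₂ (here v≡p)  = ⊥-elim (v≢p v≡p)
    ... | no _    | inj₂ (there v∈ps) = inj₂ v∈ps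

  InH-agreeOff : (ps : List Pt) → All (λ p → δ n p ∈ gens) ps →
                 ∀ {f g} → (∀ v → f v ≡ g v ⊎ proj₁ v ∈ ps) → InH n gens g → InH n gens f
  InH-agreeOff ps δps∈gens {f} {g} agree hg = resp pointwise (add hg (InH-supportedOn ps δps∈gens supp))
    where
    pointwise : ∀ v → g v ℤ.+ (f v - g v) ≡ f v
    pointwise v = solve 2 (λ a b → b :+ (a :- b) := a) refl (f v) (g v)
    supp : ∀ v → f v - g v ≡ + 0 ⊎ proj₁ v ∈ ps
    supp v with agree v
    ... | inj₁ fv≡gv = inj₁ (trans (cong (_- g v) fv≡gv) (ℤP.+-inverseʳ (g v)))
    ... | inj₂ v∈ps  = inj₂ v∈ps


-- Restricting to a copy and gluing back

module OnCopy (m : ℕ) (C : Copy m) where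
  open Copy C public

  cornerGens : List (Vtx m → ℤ)
  cornerGens = δ m κ₁ ∷ δ m κ₂ ∷ []

  H : (Vtx m → ℤ) → Set
  H = InH m cornerGens

  corners : List Pt
  corners = κ₁ ∷ κ₂ ∷ []

  corners-δ∈ : All (λ p → δ m p ∈ cornerGens) corners
  corners-δ∈ = here refl ∷ there (here refl) ∷ []

  embed : Vtx m → Vtx (suc m)
  embed (q , t) = embPt q , inCopy⇒inG (embPt q) (inCopy-embPt q t)

  unembed : (w : Vtx (suc m)) → T (inCopy (proj₁ w)) → Vtx m
  unembed w t = unembPt (proj₁ w) , inG-unembPt _ t

  embPt-injective : ∀ {p q} → embPt p ≡ embPt q → p ≡ q
  embPt-injective {p} {q} e = trans (sym (unembPt-embPt p)) (trans (cong unembPt e) (unembPt-embPt q))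

  isJunction⇒∈corners : ∀ v → T (isJunction m (embPt (proj₁ v))) → proj₁ v ∈ corners
  isJunction⇒∈corners (q , t) tJ with isJunction⇒κ q t tJ
  ... | inj₁ q≡κ₁ = here q≡κ₁
  ... | inj₂ q≡κ₂ = there (here q≡κ₂)

  ∈corners⇒isJunction : ∀ {q} → q ∈ corners → T (isJunction m (embPt q))
  ∈corners⇒isJunction (here refl)         = κ₁-isJunction
  ∈corners⇒isJunction (there (here refl)) = κ₂-isJunction

  caseCorner : ∀ {P : Set} v → (isJunction m (embPt (proj₁ v)) ≡ false → P) → P ⊎ proj₁ v ∈ corners
  caseCorner v k with caseJunction m (embPt (proj₁ v)) k
  ... | inj₁ p  = inj₁ p
  ... | inj₂ tJ = inj₂ (isJunction⇒∈corners v tJ)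

  H-supportedOnCorners : ∀ {f} → (∀ v → f v ≡ + 0 ⊎ T (isJunction m (embPt (proj₁ v)))) → H f
  H-supportedOnCorners supp = InH-supportedOn corners corners-δ∈ λ v → map₂ (isJunction⇒∈corners v) (supp v)

  -- Away from the junctions the neighbours of a vertex of the copy are those of G_m.
  Δ-inCopy : ∀ c w (t : T (inCopy (proj₁ w))) → isJunction m (proj₁ w) ≡ false →
             Δ (suc m) c w ≡ Δ m (c ∘ embed) (unembed w t)
  Δ-inCopy c w t ¬J = cong₂ _-_ (cong (λ s → + 4 ℤ.* s) (cong-vtx {suc m} c (sym (embPt-unembPt _ t)))) sums
    where
    ns = rawNbrs m (unembPt (proj₁ w))
    sums : sumℤ (map c (nbrs (suc m) w)) ≡ sumℤ (map (c ∘ embed) (nbrs m (unembed w t)))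
    sums = begin
      sumℤ (map c (nbrs (suc m) w))                               ≡⟨ sumℤ-nbrs (suc m) c w ⟩
      sumℤ (map (extend (suc m) c) (rawNbrs (suc m) (proj₁ w)))    ≡⟨ cong (sumℤ ∘ map (extend (suc m) c)) (rawNbrs-inCopy _ t ¬J) ⟩
      sumℤ (map (extend (suc m) c) (map embPt ns))                 ≡⟨ sumℤ-map-∘ (extend (suc m) c) embPt ns ⟩
      sumℤ (map (extend (suc m) c ∘ embPt) ns)                     ≡⟨ sumℤ-congᴬ (rawNbrs-inG m _) (λ q tq →
           trans (extend-inG (suc m) c (embPt q) _) (sym (extend-inG m (c ∘ embed) q tq))) ⟩
      sumℤ (map (extend m (c ∘ embed)) ns)                         ≡⟨ sym (sumℤ-nbrs m (c ∘ embed) (unembed w t)) ⟩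
      sumℤ (map (c ∘ embed) (nbrs m (unembed w t)))                ∎
      where open ≡-Reasoning

  Δ-embed : ∀ c v → isJunction m (embPt (proj₁ v)) ≡ false → Δ (suc m) c (embed v) ≡ Δ m (c ∘ embed) v
  Δ-embed c v ¬J = trans (Δ-inCopy c (embed v) (inCopy-embPt _ (proj₂ v)) ¬J) (cong-vtx {m} (Δ m (c ∘ embed)) (unembPt-embPt (proj₁ v)))

  H-Δ∘embed : ∀ c → H (Δ (suc m) c ∘ embed)
  H-Δ∘embed c = InH-agreeOff corners corners-δ∈ (λ v → caseCorner v (Δ-embed c v)) (lap (c ∘ embed))

  glue : (Vtx m → ℤ) → Vtx (suc m) → ℤ
  glue t w = if isJunction m (proj₁ w) then + 0 else (if inCopy (proj₁ w) then extend m t (unembPt (proj₁ w)) else + 0)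

  glue-inCopy : ∀ t w (tC : T (inCopy (proj₁ w))) → isJunction m (proj₁ w) ≡ false → glue t w ≡ t (unembed w tC)
  glue-inCopy t w tC ¬J rewrite ¬J | T⇒true tC = extend-inG m t _ _

  glue-isJunction : ∀ t w → T (isJunction m (proj₁ w)) → glue t w ≡ + 0
  glue-isJunction t w tJ rewrite T⇒true tJ = refl

  glue-outside : ∀ t w → inCopy (proj₁ w) ≡ false → glue t w ≡ + 0
  glue-outside t w ∉C rewrite ∉C with isJunction m (proj₁ w)
  ... | true  = refl
  ... | false = refl

  glue-map : ∀ t (F : ℤ → ℤ) → F (+ 0) ≡ + 0 → ∀ w → glue (F ∘ t) w ≡ F (glue t w)
  glue-map t F F0≡0 w with isJunction m (proj₁ w) | inCopy (proj₁ w)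
  ... | true  | _     = sym F0≡0
  ... | false | false = sym F0≡0
  ... | false | true  = extend-map m t F F0≡0 _

  glue-⊕ : ∀ f g w → glue (f ⊕ g) w ≡ glue f w ℤ.+ glue g w
  glue-⊕ f g w with isJunction m (proj₁ w) | inCopy (proj₁ w)
  ... | true  | _     = refl
  ... | false | false = refl
  ... | false | true  = extend-⊕ m f g _

  glue-cong : ∀ {f g} → (∀ v → f v ≡ g v) → ∀ w → glue f w ≡ glue g w
  glue-cong f≗g w with isJunction m (proj₁ w) | inCopy (proj₁ w)
  ... | true  | _     = refl
  ... | false | false = refl
  ... | false | true  = extend-cong m f≗g _

  glue-0 : ∀ w → glue (λ _ → + 0) w ≡ + 0
  glue-0 = glue-map (λ _ → + 0) (λ _ → + 0) refl

  glue-embed : ∀ t v → glue t (embed v) ≡ t v ⊎ proj₁ v ∈ corners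
  glue-embed t v = caseCorner v λ ¬J →
    trans (glue-inCopy t (embed v) (inCopy-embPt _ (proj₂ v)) ¬J) (cong-vtx {m} t (unembPt-embPt (proj₁ v)))

  glue-embed-offCorners : ∀ t → (∀ (v : Vtx m) → proj₁ v ∈ corners → t v ≡ + 0) → ∀ v → glue t (embed v) ≡ t v
  glue-embed-offCorners t t≗0 v with glue-embed t v
  ... | inj₁ e    = e
  ... | inj₂ v∈κ = trans (glue-isJunction t (embed v) (∈corners⇒isJunction v∈κ)) (sym (t≗0 v v∈κ))

  glue-agree : ∀ (t : Vtx m → ℤ) (f : Vtx (suc m) → ℤ) → (∀ w → inCopy (proj₁ w) ≡ false → f w ≡ + 0) →
               (∀ w (tC : T (inCopy (proj₁ w))) → isJunction m (proj₁ w) ≡ false → t (unembed w tC) ≡ f w) →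
               ∀ w → glue t w ≡ f w ⊎ T (isJunction m (proj₁ w))
  glue-agree t f f-outside f-inside w = caseJunction m (proj₁ w) agree
    where
    agree : isJunction m (proj₁ w) ≡ false → glue t w ≡ f w
    agree ¬J with T? (inCopy (proj₁ w))
    ... | no ¬tC = trans (glue-outside t w (¬T⇒false ¬tC)) (sym (f-outside w (¬T⇒false ¬tC)))
    ... | yes tC = trans (glue-inCopy t w tC ¬J) (f-inside w tC ¬J)

  glue-δκ : ∀ κ → T (isJunction m (embPt κ)) → ∀ w → glue (δ m κ) w ≡ + 0 ⊎ T (isJunction m (proj₁ w))
  glue-δκ κ tJκ = glue-agree (δ m κ) (λ _ → + 0) (λ _ _ → refl) λ w tC ¬J →
    if-false (≢⇒==ᵖ-false _ κ λ e → false⇒¬T ¬J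
      (subst (λ s → T (isJunction m s)) (trans (cong embPt (sym e)) (embPt-unembPt _ tC)) tJκ))

  δ-embed : ∀ κ v → δ (suc m) (embPt κ) (embed v) ≡ δ m κ v
  δ-embed κ v = cong (λ b → if b then + 1 else + 0) (==ᵖ-injective embPt embPt-injective (proj₁ v) κ)

  δ-embed-outside : ∀ p → ¬ T (inCopy p) → ∀ v → δ (suc m) p (embed v) ≡ + 0
  δ-embed-outside p ¬tC v = if-false (≢⇒==ᵖ-false (embPt (proj₁ v)) p
    λ e → ¬tC (subst (λ s → T (inCopy s)) e (inCopy-embPt _ (proj₂ v))))

  module UVector (u : Vtx (suc m) → ℤ) (κ : Pt)
                 (u-outside : ∀ w → inCopy (proj₁ w) ≡ false → u w ≡ + 0)
                 (u-embed : ∀ v → isJunction m (embPt (proj₁ v)) ≡ false → u (embed v) ≡ - Δ m (δ m κ) v) where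

    glue-Δδ : ∀ w → glue (Δ m (δ m κ)) w ≡ - u w ⊎ T (isJunction m (proj₁ w))
    glue-Δδ = glue-agree (Δ m (δ m κ)) (λ w → - u w) (λ w ∉C → cong -_ (u-outside w ∉C)) λ w tC ¬J → begin
      Δ m (δ m κ) (unembed w tC)       ≡⟨ sym (ℤP.neg-involutive _) ⟩
      - - Δ m (δ m κ) (unembed w tC)   ≡⟨ cong -_ (sym (u-embed (unembed w tC)
                                            (subst (λ s → isJunction m s ≡ false) (sym (embPt-unembPt _ tC)) ¬J))) ⟩
      - u (embed (unembed w tC))       ≡⟨ cong -_ (cong-vtx {suc m} u (embPt-unembPt _ tC)) ⟩
      - u w                            ∎
      where open ≡-Reasoning

    H-u∘embed : H (u ∘ embed)
    H-u∘embed = InH-agreeOff corners corners-δ∈ (λ v → caseCorner v (u-embed v)) (neg (lap (δ m κ)))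

module OnCopyPair (m : ℕ) (C D : Copy m)
                  (C∩D⇒isJunction : ∀ p → T (Copy.inCopy C p) → T (Copy.inCopy D p) → T (isJunction m p)) where
  private
    module C = OnCopy m C
    module D = OnCopy m D

  glue-inOther : ∀ t w → T (D.inCopy (proj₁ w)) → isJunction m (proj₁ w) ≡ false → C.glue t w ≡ + 0
  glue-inOther t w tD ¬J = C.glue-outside t w (¬T⇒false λ tC → false⇒¬T ¬J (C∩D⇒isJunction _ tC tD))

  glue-embedOther : ∀ t v → C.glue t (D.embed v) ≡ + 0
  glue-embedOther t v with T? (isJunction m (D.embPt (proj₁ v)))
  ... | yes tJ = C.glue-isJunction t (D.embed v) tJ
  ... | no ¬tJ = glue-inOther t (D.embed v) (D.inCopy-embPt _ (proj₂ v)) (¬T⇒false ¬tJ)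

  H-outside∘embed : ∀ F → (∀ w → C.inCopy (proj₁ w) ≡ false → F w ≡ + 0) → D.H (F ∘ D.embed)
  H-outside∘embed F F-outside = D.H-supportedOnCorners supp
    where
    supp : ∀ v → F (D.embed v) ≡ + 0 ⊎ T (isJunction m (D.embPt (proj₁ v)))
    supp v with T? (C.inCopy (D.embPt (proj₁ v)))
    ... | yes tC  = inj₂ (C∩D⇒isJunction _ tC (D.inCopy-embPt _ (proj₂ v)))
    ... | no ¬tC = inj₁ (F-outside (D.embed v) (¬T⇒false ¬tC))


-- Adjacency at the corners is symmetric

indicator : Bool → ℤ
indicator b = if b then + 1 else + 0

count : Pt → List Pt → ℤ
count κ ps = sumℤ (map (λ p → indicator (p ==ᵖ κ)) ps)

-- adj n p q is member q (rawNbrs n p) by definition.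
member : Pt → List Pt → Bool
member q ps = foldr (λ r b → (r ==ᵖ q) ∨ b) false ps

member-++ : ∀ q ps rs → member q (ps ++ rs) ≡ member q ps ∨ member q rs
member-++ q []       rs = refl
member-++ q (p ∷ ps) rs = trans (cong ((p ==ᵖ q) ∨_) (member-++ q ps rs)) (sym (BP.∨-assoc (p ==ᵖ q) _ _))

count-++ : ∀ κ ps rs → count κ (ps ++ rs) ≡ count κ ps ℤ.+ count κ rs
count-++ κ = sumℤ-++ (λ p → indicator (p ==ᵖ κ))

module _ (f : Pt → Pt) (f-inj : ∀ {p q} → f p ≡ f q → p ≡ q) where

  member-map : ∀ q ps → member (f q) (map f ps) ≡ member q ps
  member-map q []       = refl
  member-map q (p ∷ ps) = cong₂ _∨_ (==ᵖ-injective f f-inj p q) (member-map q ps)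

  count-map : ∀ κ ps → count (f κ) (map f ps) ≡ count κ ps
  count-map κ []       = refl
  count-map κ (p ∷ ps) = cong₂ ℤ._+_ (cong indicator (==ᵖ-injective f f-inj p κ)) (count-map κ ps)

member-none : ∀ q {ps} → All (λ p → ¬ p ≡ q) ps → member q ps ≡ false
member-none q []           = refl
member-none q {p ∷ _} (p≢q ∷ ps≢q) = cong₂ _∨_ (≢⇒==ᵖ-false p q p≢q) (member-none q ps≢q)

count-none : ∀ κ {ps} → All (λ p → ¬ p ≡ κ) ps → count κ ps ≡ + 0
count-none κ []           = refl
count-none κ {p ∷ _} (p≢κ ∷ ps≢κ) = cong₂ ℤ._+_ (cong indicator (≢⇒==ᵖ-false p κ p≢κ)) (count-none κ ps≢κ)

count-if : ∀ κ b ps → count κ (if b then ps else []) ≡ (if b then count κ ps else + 0)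
count-if κ true  ps = refl
count-if κ false ps = refl

count-if-map-none : ∀ κ (f : Pt → Pt) → (∀ p → ¬ f p ≡ κ) → ∀ b ps → count κ (if b then map f ps else []) ≡ + 0
count-if-map-none κ f f≢κ true  ps = count-none κ (AllP.map⁺ (All.universal f≢κ ps))
count-if-map-none κ f f≢κ false ps = refl

if-inG-rawNbrs : ∀ m q → (if inG m q then rawNbrs m q else []) ≡ rawNbrs m q
if-inG-rawNbrs m q with T? (inG m q)
... | yes t  = if-T t
... | no ¬t = trans (if-false (¬T⇒false ¬t)) (sym (rawNbrs-∉ m q ¬t))

2^m<2^[1+m] : ∀ m → 2 ^ m ℕ.< 2 ^ suc m
2^m<2^[1+m] m = subst (2 ^ m ℕ.<_) (2^m+2^m≡2^[1+m] m) (ℕP.m<m+n (2 ^ m) (ℕP.m^n>0 2 m))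

inG⇒coordinate≢2^[1+m] : ∀ m a b → T (inG m (a , b)) → ¬ (a ≡ 2 ^ suc m ⊎ b ≡ 2 ^ suc m)
inG⇒coordinate≢2^[1+m] m a b t e = ℕP.<⇒≱ (2^m<2^[1+m] m) (ℕP.≤-trans (2^[1+m]≤a+b e) (inG⇒i+j≤2^m m a b t))
  where
  2^[1+m]≤a+b : a ≡ 2 ^ suc m ⊎ b ≡ 2 ^ suc m → 2 ^ suc m ≤ a ℕ.+ b
  2^[1+m]≤a+b (inj₁ refl) = ℕP.m≤m+n _ b
  2^[1+m]≤a+b (inj₂ refl) = ℕP.m≤n+m _ a

+2^m≢0 : ∀ m a → ¬ a ℕ.+ 2 ^ m ≡ 0
+2^m≢0 m a = 2^m≢0 m ∘ ℕP.m+n≡0⇒n≡0 a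

rawNbrs-xc : ∀ m → rawNbrs m (xc m) ≡ (1 , 0) ∷ (0 , 1) ∷ []
rawNbrs-xc zero    = refl
rawNbrs-xc (suc m) =
  trans (cong₂ _++_ (if-T {b = inG m (0 , 0)} (inG-xc m))
          (cong₂ _++_ (if-false {b = (2 ^ m ≤ᵇ 0) ∧ inG m (0 ∸ 2 ^ m , 0)} (cong (_∧ inG m (0 ∸ 2 ^ m , 0)) (2^m≤ᵇ0≡false m)))
                      (if-false {b = (2 ^ m ≤ᵇ 0) ∧ inG m (0 , 0 ∸ 2 ^ m)} (cong (_∧ inG m (0 , 0 ∸ 2 ^ m)) (2^m≤ᵇ0≡false m)))))
  (trans (LP.++-identityʳ _) (rawNbrs-xc m))

yc-suc : ∀ m → yc (suc m) ≡ shift (2 ^ m) 0 (yc m)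
yc-suc m = cong (_, 0) (cong (2 ^ m ℕ.+_) (ℕP.+-identityʳ (2 ^ m)))

zc-suc : ∀ m → zc (suc m) ≡ shift 0 (2 ^ m) (zc m)
zc-suc m = cong (0 ,_) (cong (2 ^ m ℕ.+_) (ℕP.+-identityʳ (2 ^ m)))

nbr-symmetry₀ : ∀ κ → T (inG 0 κ) → ∀ q → indicator (member q (rawNbrs 0 κ)) ≡ count κ (rawNbrs 0 q)
nbr-symmetry₀ (0 , 0) _ (0 , 0)             = refl
nbr-symmetry₀ (0 , 0) _ (1 , 0)             = refl
nbr-symmetry₀ (0 , 0) _ (0 , 1)             = refl
nbr-symmetry₀ (0 , 0) _ (1 , suc j)         = refl
nbr-symmetry₀ (0 , 0) _ (0 , suc (suc j))   = refl
nbr-symmetry₀ (0 , 0) _ (suc (suc i) , j)   = refl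
nbr-symmetry₀ (1 , 0) _ (0 , 0)             = refl
nbr-symmetry₀ (1 , 0) _ (1 , 0)             = refl
nbr-symmetry₀ (1 , 0) _ (0 , 1)             = refl
nbr-symmetry₀ (1 , 0) _ (1 , suc j)         = refl
nbr-symmetry₀ (1 , 0) _ (0 , suc (suc j))   = refl
nbr-symmetry₀ (1 , 0) _ (suc (suc i) , j)   = refl
nbr-symmetry₀ (0 , 1) _ (0 , 0)             = refl
nbr-symmetry₀ (0 , 1) _ (1 , 0)             = refl
nbr-symmetry₀ (0 , 1) _ (0 , 1)             = refl
nbr-symmetry₀ (0 , 1) _ (1 , suc j)         = refl
nbr-symmetry₀ (0 , 1) _ (0 , suc (suc j))   = refl
nbr-symmetry₀ (0 , 1) _ (suc (suc i) , j)   = refl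

module CornerNbrs (m : ℕ) where
  private
    N = 2 ^ m
    module R = OnCopy m (lowerRightCopy m)
    module U = OnCopy m (upperCopy m)

  blockL blockR blockU : ℕ → ℕ → List Pt
  blockL i j = if inG m (i , j) then rawNbrs m (i , j) else []
  blockR i j = if inLowerRight m (i , j) then map (shift N 0) (rawNbrs m (i ∸ N , j)) else []
  blockU i j = if inUpper m (i , j) then map (shift 0 N) (rawNbrs m (i , j ∸ N)) else []

  count-rawNbrs-suc : ∀ κ i j →
    count κ (rawNbrs (suc m) (i , j)) ≡ count κ (blockL i j) ℤ.+ (count κ (blockR i j) ℤ.+ count κ (blockU i j))
  count-rawNbrs-suc κ i j =
    trans (count-++ κ (blockL i j) (blockR i j ++ blockU i j)) (cong (λ s → count κ (blockL i j) ℤ.+ s) (count-++ κ (blockR i j) (blockU i j)))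

  count-xc-suc : ∀ q → count (xc (suc m)) (rawNbrs (suc m) q) ≡ count (xc m) (rawNbrs m q)
  count-xc-suc (i , j) = begin
    count (0 , 0) (rawNbrs (suc m) (i , j))
      ≡⟨ count-rawNbrs-suc (0 , 0) i j ⟩
    count (0 , 0) (blockL i j) ℤ.+ (count (0 , 0) (blockR i j) ℤ.+ count (0 , 0) (blockU i j))
      ≡⟨ cong₂ ℤ._+_ (cong (count (0 , 0)) (if-inG-rawNbrs m (i , j)))
           (cong₂ ℤ._+_ (count-if-map-none (0 , 0) (shift N 0) (λ r e → +2^m≢0 m (proj₁ r) (cong proj₁ e)) (inLowerRight m (i , j)) _)
                        (count-if-map-none (0 , 0) (shift 0 N) (λ r e → +2^m≢0 m (proj₂ r) (cong proj₂ e)) (inUpper m (i , j)) _)) ⟩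
    count (0 , 0) (rawNbrs m (i , j)) ℤ.+ + 0
      ≡⟨ ℤP.+-identityʳ _ ⟩
    count (0 , 0) (rawNbrs m (i , j)) ∎
    where open ≡-Reasoning

  count-yc-suc : ∀ q → count (yc (suc m)) (rawNbrs (suc m) q) ≡
                       (if inLowerRight m q then count (yc m) (rawNbrs m (R.unembPt q)) else + 0)
  count-yc-suc (i , j) = begin
    count y′ (rawNbrs (suc m) (i , j))
      ≡⟨ count-rawNbrs-suc y′ i j ⟩
    count y′ (blockL i j) ℤ.+ (count y′ (blockR i j) ℤ.+ count y′ (blockU i j))
      ≡⟨ cong₂ ℤ._+_ (trans (cong (count y′) (if-inG-rawNbrs m (i , j)))
                            (count-none y′ (All.map (λ tr e → inG⇒coordinate≢2^[1+m] m _ _ tr (inj₁ (cong proj₁ e)))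
                                                    (rawNbrs-inG m (i , j)))))
           (cong₂ ℤ._+_ (trans (count-if y′ (inLowerRight m (i , j)) _)
                               (BP.if-cong-then (inLowerRight m (i , j))
                                  (trans (cong (λ s → count s (map (shift N 0) ns)) (yc-suc m))
                                         (count-map (shift N 0) R.embPt-injective (yc m) ns))))
                        (count-if-map-none y′ (shift 0 N) (λ r e → +2^m≢0 m (proj₂ r) (cong proj₂ e)) (inUpper m (i , j)) _)) ⟩
    + 0 ℤ.+ ((if inLowerRight m (i , j) then count (yc m) ns else + 0) ℤ.+ + 0)
      ≡⟨ trans (ℤP.+-identityˡ _) (ℤP.+-identityʳ _) ⟩
    (if inLowerRight m (i , j) then count (yc m) ns else + 0) ∎
    where open ≡-Reasoning; y′ = yc (suc m); ns = rawNbrs m (i ∸ N , j)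

  count-zc-suc : ∀ q → count (zc (suc m)) (rawNbrs (suc m) q) ≡
                       (if inUpper m q then count (zc m) (rawNbrs m (U.unembPt q)) else + 0)
  count-zc-suc (i , j) = begin
    count z′ (rawNbrs (suc m) (i , j))
      ≡⟨ count-rawNbrs-suc z′ i j ⟩
    count z′ (blockL i j) ℤ.+ (count z′ (blockR i j) ℤ.+ count z′ (blockU i j))
      ≡⟨ cong₂ ℤ._+_ (trans (cong (count z′) (if-inG-rawNbrs m (i , j)))
                            (count-none z′ (All.map (λ tr e → inG⇒coordinate≢2^[1+m] m _ _ tr (inj₂ (cong proj₂ e)))
                                                    (rawNbrs-inG m (i , j)))))
           (cong₂ ℤ._+_ (count-if-map-none z′ (shift N 0) (λ r e → +2^m≢0 m (proj₁ r) (cong proj₁ e)) (inLowerRight m (i , j)) _)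
                        (trans (count-if z′ (inUpper m (i , j)) _)
                               (BP.if-cong-then (inUpper m (i , j))
                                  (trans (cong (λ s → count s (map (shift 0 N) ns)) (zc-suc m))
                                         (count-map (shift 0 N) U.embPt-injective (zc m) ns))))) ⟩
    + 0 ℤ.+ (+ 0 ℤ.+ (if inUpper m (i , j) then count (zc m) ns else + 0))
      ≡⟨ trans (ℤP.+-identityˡ _) (ℤP.+-identityˡ _) ⟩
    (if inUpper m (i , j) then count (zc m) ns else + 0) ∎
    where open ≡-Reasoning; z′ = zc (suc m); ns = rawNbrs m (i , j ∸ N)

  rawNbrs-yc-suc : rawNbrs (suc m) (yc (suc m)) ≡ map (shift N 0) (rawNbrs m (yc m))
  rawNbrs-yc-suc =
    trans (cong₂ _++_ (if-false {b = inG m (2 ^ suc m , 0)} (¬T⇒false (λ t → inG⇒coordinate≢2^[1+m] m _ 0 t (inj₁ refl))))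
           (cong₂ _++_ (if-T {b = inLowerRight m (yc (suc m))} (inLowerRight-yc m))
                       (if-false {b = (N ≤ᵇ 0) ∧ inG m (2 ^ suc m , 0 ∸ N)} (cong (_∧ inG m (2 ^ suc m , 0 ∸ N)) (2^m≤ᵇ0≡false m)))))
    (trans (LP.++-identityʳ _) (cong (λ s → map (shift N 0) (rawNbrs m (s , 0))) (2^[1+m]∸2^m≡2^m m)))

  rawNbrs-zc-suc : rawNbrs (suc m) (zc (suc m)) ≡ map (shift 0 N) (rawNbrs m (zc m))
  rawNbrs-zc-suc =
    trans (cong₂ _++_ (if-false {b = inG m (0 , 2 ^ suc m)} (¬T⇒false (λ t → inG⇒coordinate≢2^[1+m] m 0 _ t (inj₂ refl))))
           (cong₂ _++_ (if-false {b = (N ≤ᵇ 0) ∧ inG m (0 ∸ N , 2 ^ suc m)} (cong (_∧ inG m (0 ∸ N , 2 ^ suc m)) (2^m≤ᵇ0≡false m)))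
                       (if-T {b = inUpper m (zc (suc m))} (inUpper-zc m))))
    (cong (λ s → map (shift 0 N) (rawNbrs m (0 , s))) (2^[1+m]∸2^m≡2^m m))

module _ {m : ℕ} (C : Copy m) where
  open Copy C

  member-map-embPt : ∀ q ps → All (λ r → T (inG m r)) ps →
    member q (map embPt ps) ≡ (if inCopy q then member (unembPt q) ps else false)
  member-map-embPt q ps ps∈G with T? (inCopy q)
  ... | yes tC = trans (cong (λ s → member s (map embPt ps)) (sym (embPt-unembPt q tC)))
                   (trans (member-map embPt (OnCopy.embPt-injective m C) (unembPt q) ps) (sym (if-T tC)))
  ... | no ¬tC = trans (member-none q (AllP.map⁺ (All.map (λ {r} tr e → ¬tC (subst (T ∘ inCopy) e (inCopy-embPt r tr))) ps∈G)))
                   (sym (if-false (¬T⇒false ¬tC)))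

nbr-symmetry-xc : ∀ m q → indicator (member q (rawNbrs m (xc m))) ≡ count (xc m) (rawNbrs m q)
nbr-symmetry-xc zero    q = nbr-symmetry₀ _ tt q
nbr-symmetry-xc (suc m) q =
  trans (cong (λ ps → indicator (member q ps)) (trans (rawNbrs-xc (suc m)) (sym (rawNbrs-xc m))))
        (trans (nbr-symmetry-xc m q) (sym (CornerNbrs.count-xc-suc m q)))

nbr-symmetry-yc : ∀ m q → indicator (member q (rawNbrs m (yc m))) ≡ count (yc m) (rawNbrs m q)
nbr-symmetry-yc zero    q = nbr-symmetry₀ _ tt q
nbr-symmetry-yc (suc m) q = begin
  indicator (member q (rawNbrs (suc m) (yc (suc m))))
    ≡⟨ cong (λ ps → indicator (member q ps)) rawNbrs-yc-suc ⟩
  indicator (member q (map (shift (2 ^ m) 0) (rawNbrs m (yc m))))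
    ≡⟨ cong indicator (member-map-embPt (lowerRightCopy m) q _ (rawNbrs-inG m (yc m))) ⟩
  indicator (if inLowerRight m q then member q′ (rawNbrs m (yc m)) else false)
    ≡⟨ BP.if-float indicator (inLowerRight m q) ⟩
  (if inLowerRight m q then indicator (member q′ (rawNbrs m (yc m))) else + 0)
    ≡⟨ BP.if-cong-then (inLowerRight m q) (nbr-symmetry-yc m q′) ⟩
  (if inLowerRight m q then count (yc m) (rawNbrs m q′) else + 0)
    ≡⟨ sym (count-yc-suc q) ⟩
  count (yc (suc m)) (rawNbrs (suc m) q) ∎
  where open ≡-Reasoning; open CornerNbrs m; q′ = Copy.unembPt (lowerRightCopy m) q

nbr-symmetry-zc : ∀ m q → indicator (member q (rawNbrs m (zc m))) ≡ count (zc m) (rawNbrs m q)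
nbr-symmetry-zc zero    q = nbr-symmetry₀ _ tt q
nbr-symmetry-zc (suc m) q = begin
  indicator (member q (rawNbrs (suc m) (zc (suc m))))
    ≡⟨ cong (λ ps → indicator (member q ps)) rawNbrs-zc-suc ⟩
  indicator (member q (map (shift 0 (2 ^ m)) (rawNbrs m (zc m))))
    ≡⟨ cong indicator (member-map-embPt (upperCopy m) q _ (rawNbrs-inG m (zc m))) ⟩
  indicator (if inUpper m q then member q′ (rawNbrs m (zc m)) else false)
    ≡⟨ BP.if-float indicator (inUpper m q) ⟩
  (if inUpper m q then indicator (member q′ (rawNbrs m (zc m))) else + 0)
    ≡⟨ BP.if-cong-then (inUpper m q) (nbr-symmetry-zc m q′) ⟩
  (if inUpper m q then count (zc m) (rawNbrs m q′) else + 0)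
    ≡⟨ sym (count-zc-suc q) ⟩
  count (zc (suc m)) (rawNbrs (suc m) q) ∎
  where open ≡-Reasoning; open CornerNbrs m; q′ = Copy.unembPt (upperCopy m) q


extend-δ : ∀ n κ → T (inG n κ) → ∀ p → extend n (δ n κ) p ≡ indicator (p ==ᵖ κ)
extend-δ n κ tκ p = byMembership (T? (inG n p))
  where
  byMembership : Dec (T (inG n p)) → extend n (δ n κ) p ≡ indicator (p ==ᵖ κ)
  byMembership (yes t)  = extend-inG n (δ n κ) p t
  byMembership (no ¬t) = trans (extend-∉ n (δ n κ) p ¬t)
    (sym (cong indicator (≢⇒==ᵖ-false p κ (λ e → ¬t (subst (T ∘ inG n) (sym e) tκ)))))

Δδ-off : ∀ n κ → T (inG n κ) → ∀ v → ¬ proj₁ v ≡ κ → Δ n (δ n κ) v ≡ - count κ (rawNbrs n (proj₁ v))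
Δδ-off n κ tκ v v≢κ =
  trans (cong₂ _-_ (cong (λ b → + 4 ℤ.* indicator b) (≢⇒==ᵖ-false (proj₁ v) κ v≢κ))
                   (trans (sumℤ-nbrs n (δ n κ) v) (sumℤ-cong (rawNbrs n (proj₁ v)) (extend-δ n κ tκ))))
        (ℤP.+-identityˡ _)

if-∧-T : ∀ a b → T b → (if a ∧ b then + 1 else + 0) ≡ indicator a
if-∧-T a true _ = cong indicator (BP.∧-identityʳ a)

if-∧-false : ∀ a b → b ≡ false → (if a ∧ b then + 1 else + 0) ≡ + 0
if-∧-false a b refl rewrite BP.∧-zeroʳ a = refl

module UVectors (m : ℕ) where
  private
    N = 2 ^ m
    module U = OnCopy m (upperCopy m)
    module L = OnCopy m (lowerLeftCopy m)
    module R = OnCopy m (lowerRightCopy m)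

  bJ∉G : ¬ T (inG m (bJ m))
  bJ∉G t = 2^m≢0 m (proj₁ (m+n≤o≤m⇒n≡0×m≡o N N N (inG⇒i+j≤2^m m N N t) ℕP.≤-refl))

  inUpper-N-N∸N : ∀ {i} → T (inG m (i , 0)) → T ((N ≤ᵇ N) ∧ inG m (i , N ∸ N))
  inUpper-N-N∸N {i} t = T-∧-intro (ℕP.≤⇒≤ᵇ {N} ℕP.≤-refl) (subst (λ s → T (inG m (i , s))) (sym (ℕP.n∸n≡0 N)) t)

  inLowerRight-N∸N : ∀ {j} → T (inG m (0 , j)) → T ((N ≤ᵇ N) ∧ inG m (N ∸ N , j))
  inLowerRight-N∸N {j} t = T-∧-intro (ℕP.≤⇒≤ᵇ {N} ℕP.≤-refl) (subst (λ s → T (inG m (s , j))) (sym (ℕP.n∸n≡0 N)) t)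

  rawNbrs-aJ : rawNbrs (suc m) (aJ m) ≡ rawNbrs m (zc m) ++ map (shift 0 N) (rawNbrs m (xc m))
  rawNbrs-aJ = cong₂ _++_ (if-T {b = inG m (0 , N)} (inG-zc m))
    (cong₂ _++_ (if-false {b = (N ≤ᵇ 0) ∧ inG m (0 ∸ N , N)} (cong (_∧ inG m (0 ∸ N , N)) (2^m≤ᵇ0≡false m)))
       (trans (if-T {b = (N ≤ᵇ N) ∧ inG m (0 , N ∸ N)} (inUpper-N-N∸N (inG-xc m)))
              (cong (λ s → map (shift 0 N) (rawNbrs m (0 , s))) (ℕP.n∸n≡0 N))))

  rawNbrs-cJ : rawNbrs (suc m) (cJ m) ≡ rawNbrs m (yc m) ++ (map (shift N 0) (rawNbrs m (xc m)) ++ [])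
  rawNbrs-cJ = cong₂ _++_ (if-T {b = inG m (N , 0)} (inG-yc m))
    (cong₂ _++_ (trans (if-T {b = (N ≤ᵇ N) ∧ inG m (N ∸ N , 0)} (inLowerRight-N∸N (inG-xc m)))
                       (cong (λ s → map (shift N 0) (rawNbrs m (s , 0))) (ℕP.n∸n≡0 N)))
       (if-false {b = (N ≤ᵇ 0) ∧ inG m (N , 0 ∸ N)} (cong (_∧ inG m (N , 0 ∸ N)) (2^m≤ᵇ0≡false m))))

  rawNbrs-bJ : rawNbrs (suc m) (bJ m) ≡ map (shift N 0) (rawNbrs m (zc m)) ++ map (shift 0 N) (rawNbrs m (yc m))
  rawNbrs-bJ = cong₂ _++_ (if-false {b = inG m (N , N)} (¬T⇒false bJ∉G))
    (cong₂ _++_ (trans (if-T {b = (N ≤ᵇ N) ∧ inG m (N ∸ N , N)} (inLowerRight-N∸N (inG-zc m)))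
                       (cong (λ s → map (shift N 0) (rawNbrs m (s , N))) (ℕP.n∸n≡0 N)))
                (trans (if-T {b = (N ≤ᵇ N) ∧ inG m (N , N ∸ N)} (inUpper-N-N∸N (inG-yc m)))
                       (cong (λ s → map (shift 0 N) (rawNbrs m (N , s))) (ℕP.n∸n≡0 N))))

  -- The neighbours of the junction that lie in another copy are junctions themselves,
  -- so they miss a non-junction vertex; what remains is the symmetry at a corner of G_m.
  u↑-embed : ∀ v → isJunction m (U.embPt (proj₁ v)) ≡ false → u↑ m (U.embed v) ≡ - Δ m (δ m (xc m)) v
  u↑-embed v ¬J = begin
    u↑ m (U.embed v)
      ≡⟨ if-∧-T (adj (suc m) (aJ m) q) (inUpper m q) tU ⟩
    indicator (member q (rawNbrs (suc m) (aJ m)))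
      ≡⟨ cong (λ ps → indicator (member q ps)) rawNbrs-aJ ⟩
    indicator (member q (rawNbrs m (zc m) ++ map (shift 0 N) (rawNbrs m (xc m))))
      ≡⟨ cong indicator (member-++ q (rawNbrs m (zc m)) _) ⟩
    indicator (member q (rawNbrs m (zc m)) ∨ member q (map (shift 0 N) (rawNbrs m (xc m))))
      ≡⟨ cong₂ (λ a b → indicator (a ∨ b))
           (member-none q (All.map (λ {r} tr e → false⇒¬T ¬J
              (inLowerLeft∧inUpper⇒isJunction m q (subst (T ∘ inG m) e tr) tU)) (rawNbrs-inG m (zc m))))
           (member-map (shift 0 N) U.embPt-injective (proj₁ v) (rawNbrs m (xc m))) ⟩
    indicator (member (proj₁ v) (rawNbrs m (xc m)))
      ≡⟨ nbr-symmetry-xc m (proj₁ v) ⟩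
    count (xc m) (rawNbrs m (proj₁ v))
      ≡⟨ sym (ℤP.neg-involutive _) ⟩
    - - count (xc m) (rawNbrs m (proj₁ v))
      ≡⟨ cong -_ (sym (Δδ-off m (xc m) (inG-xc m) v λ e → false⇒¬T ¬J
           (subst (T ∘ isJunction m ∘ U.embPt) (sym e) U.κ₁-isJunction))) ⟩
    - Δ m (δ m (xc m)) v ∎
    where
    open ≡-Reasoning
    q = U.embPt (proj₁ v)
    tU = inUpper-shift m (proj₁ v) (proj₂ v)

  u←-embed : ∀ v → isJunction m (L.embPt (proj₁ v)) ≡ false → u← m (L.embed v) ≡ - Δ m (δ m (yc m)) v
  u←-embed v ¬J = begin
    u← m (L.embed v)
      ≡⟨ if-∧-T (adj (suc m) (cJ m) q) (inLowerLeft m q) (proj₂ v) ⟩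
    indicator (member q (rawNbrs (suc m) (cJ m)))
      ≡⟨ cong (λ ps → indicator (member q ps)) rawNbrs-cJ ⟩
    indicator (member q (rawNbrs m (yc m) ++ (map (shift N 0) (rawNbrs m (xc m)) ++ [])))
      ≡⟨ cong indicator (trans (member-++ q (rawNbrs m (yc m)) _)
                               (cong (member q (rawNbrs m (yc m)) ∨_) (member-++ q (map (shift N 0) (rawNbrs m (xc m))) []))) ⟩
    indicator (member q (rawNbrs m (yc m)) ∨ (member q (map (shift N 0) (rawNbrs m (xc m))) ∨ false))
      ≡⟨ cong (λ b → indicator (member q (rawNbrs m (yc m)) ∨ (b ∨ false)))
           (member-none q (AllP.map⁺ (All.map (λ {r} tr e → false⇒¬T ¬J
              (inLowerLeft∧inLowerRight⇒isJunction m q (proj₂ v) (subst (T ∘ inLowerRight m) e (inLowerRight-shift m r tr))))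
              (rawNbrs-inG m (xc m))))) ⟩
    indicator (member q (rawNbrs m (yc m)) ∨ false)
      ≡⟨ cong indicator (BP.∨-identityʳ _) ⟩
    indicator (member q (rawNbrs m (yc m)))
      ≡⟨ nbr-symmetry-yc m q ⟩
    count (yc m) (rawNbrs m q)
      ≡⟨ sym (ℤP.neg-involutive _) ⟩
    - - count (yc m) (rawNbrs m q)
      ≡⟨ cong -_ (sym (Δδ-off m (yc m) (inG-yc m) v λ e → false⇒¬T ¬J
           (subst (T ∘ isJunction m) (sym e) L.κ₁-isJunction))) ⟩
    - Δ m (δ m (yc m)) v ∎
    where
    open ≡-Reasoning
    q = proj₁ v

  u→-embed : ∀ v → isJunction m (R.embPt (proj₁ v)) ≡ false → u→ m (R.embed v) ≡ - Δ m (δ m (zc m)) v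
  u→-embed v ¬J = begin
    u→ m (R.embed v)
      ≡⟨ if-∧-T (adj (suc m) (bJ m) q) (inLowerRight m q) tR ⟩
    indicator (member q (rawNbrs (suc m) (bJ m)))
      ≡⟨ cong (λ ps → indicator (member q ps)) rawNbrs-bJ ⟩
    indicator (member q (map (shift N 0) (rawNbrs m (zc m)) ++ map (shift 0 N) (rawNbrs m (yc m))))
      ≡⟨ cong indicator (member-++ q (map (shift N 0) (rawNbrs m (zc m))) _) ⟩
    indicator (member q (map (shift N 0) (rawNbrs m (zc m))) ∨ member q (map (shift 0 N) (rawNbrs m (yc m))))
      ≡⟨ cong₂ (λ a b → indicator (a ∨ b))
           (member-map (shift N 0) R.embPt-injective (proj₁ v) (rawNbrs m (zc m)))
           (member-none q (AllP.map⁺ (All.map (λ {r} tr e → false⇒¬T ¬J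
              (inLowerRight∧inUpper⇒isJunction m q tR (subst (T ∘ inUpper m) e (inUpper-shift m r tr))))
              (rawNbrs-inG m (yc m))))) ⟩
    indicator (member (proj₁ v) (rawNbrs m (zc m)) ∨ false)
      ≡⟨ cong indicator (BP.∨-identityʳ _) ⟩
    indicator (member (proj₁ v) (rawNbrs m (zc m)))
      ≡⟨ nbr-symmetry-zc m (proj₁ v) ⟩
    count (zc m) (rawNbrs m (proj₁ v))
      ≡⟨ sym (ℤP.neg-involutive _) ⟩
    - - count (zc m) (rawNbrs m (proj₁ v))
      ≡⟨ cong -_ (sym (Δδ-off m (zc m) (inG-zc m) v λ e → false⇒¬T ¬J
           (subst (T ∘ isJunction m ∘ R.embPt) (sym e) R.κ₁-isJunction))) ⟩
    - Δ m (δ m (zc m)) v ∎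
    where
    open ≡-Reasoning
    q = R.embPt (proj₁ v)
    tR = inLowerRight-shift m (proj₁ v) (proj₂ v)

  u↑-outside : ∀ w → inUpper m (proj₁ w) ≡ false → u↑ m w ≡ + 0
  u↑-outside w = if-∧-false (adj (suc m) (aJ m) (proj₁ w)) (inUpper m (proj₁ w))

  u←-outside : ∀ w → inLowerLeft m (proj₁ w) ≡ false → u← m w ≡ + 0
  u←-outside w = if-∧-false (adj (suc m) (cJ m) (proj₁ w)) (inLowerLeft m (proj₁ w))

  u→-outside : ∀ w → inLowerRight m (proj₁ w) ≡ false → u→ m w ≡ + 0
  u→-outside w = if-∧-false (adj (suc m) (bJ m) (proj₁ w)) (inLowerRight m (proj₁ w))


-- Gluing the three copies together

data Part : Set where
  upper lowerLeft lowerRight : Part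

_≟ₚ_ : (s s′ : Part) → Dec (s ≡ s′)
upper      ≟ₚ upper      = yes refl
lowerLeft  ≟ₚ lowerLeft  = yes refl
lowerRight ≟ₚ lowerRight = yes refl
upper      ≟ₚ lowerLeft  = no λ ()
upper      ≟ₚ lowerRight = no λ ()
lowerLeft  ≟ₚ upper      = no λ ()
lowerLeft  ≟ₚ lowerRight = no λ ()
lowerRight ≟ₚ upper      = no λ ()
lowerRight ≟ₚ lowerLeft  = no λ ()

-- The junction shared by the copies s and next s is embPt s κ₂ = embPt (next s) κ₁;
-- third s is the copy avoiding it.
next third : Part → Part
next upper      = lowerRight
next lowerLeft  = upper
next lowerRight = lowerLeft
third upper      = lowerLeft
third lowerLeft  = lowerRight
third lowerRight = upper

split-by-indicators : ∀ b₁ b₂ (x k₁ k₂ : ℤ) → (T b₁ → k₁ ≡ x) → (T b₂ → k₂ ≡ x) → (T b₁ → b₂ ≡ false) →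
  x ≡ k₁ ℤ.* indicator b₁ ℤ.+ (k₂ ℤ.* indicator b₂ ℤ.+ (if b₁ ∨ b₂ then + 0 else x))
split-by-indicators true b₂ x k₁ k₂ k₁≡x _ b₂≡false rewrite b₂≡false tt | k₁≡x tt =
  solve 2 (λ x k₂ → x := x :* con (+ 1) :+ (k₂ :* con (+ 0) :+ con (+ 0))) refl x k₂
split-by-indicators false true x k₁ k₂ _ k₂≡x _ rewrite k₂≡x tt =
  solve 2 (λ x k₁ → x := k₁ :* con (+ 0) :+ (x :* con (+ 1) :+ con (+ 0))) refl x k₁
split-by-indicators false false x k₁ k₂ _ _ _ =
  solve 3 (λ x k₁ k₂ → x := k₁ :* con (+ 0) :+ (k₂ :* con (+ 0) :+ x)) refl x k₁ k₂

module Decomposition (m : ℕ) where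
  private
    N = 2 ^ m

  copy : Part → Copy m
  copy upper      = upperCopy m
  copy lowerLeft  = lowerLeftCopy m
  copy lowerRight = lowerRightCopy m

  module C (s : Part) = OnCopy m (copy s)

  overlap⇒isJunction : ∀ s s′ → ¬ s ≡ s′ → ∀ p → T (C.inCopy s p) → T (C.inCopy s′ p) → T (isJunction m p)
  overlap⇒isJunction upper      upper      s≢s′ _ _  _  = ⊥-elim (s≢s′ refl)
  overlap⇒isJunction lowerLeft  lowerLeft  s≢s′ _ _  _  = ⊥-elim (s≢s′ refl)
  overlap⇒isJunction lowerRight lowerRight s≢s′ _ _  _  = ⊥-elim (s≢s′ refl)
  overlap⇒isJunction upper      lowerLeft  _    p tU tL = inLowerLeft∧inUpper⇒isJunction m p tL tU
  overlap⇒isJunction upper      lowerRight _    p tU tR = inLowerRight∧inUpper⇒isJunction m p tR tU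
  overlap⇒isJunction lowerLeft  upper      _    p tL tU = inLowerLeft∧inUpper⇒isJunction m p tL tU
  overlap⇒isJunction lowerLeft  lowerRight _    p tL tR = inLowerLeft∧inLowerRight⇒isJunction m p tL tR
  overlap⇒isJunction lowerRight upper      _    p tR tU = inLowerRight∧inUpper⇒isJunction m p tR tU
  overlap⇒isJunction lowerRight lowerLeft  _    p tR tL = inLowerLeft∧inLowerRight⇒isJunction m p tL tR

  module Other (s s′ : Part) (s≢s′ : ¬ s ≡ s′) = OnCopyPair m (copy s) (copy s′) (overlap⇒isJunction s s′ s≢s′)

  whichPart : ∀ (w : Vtx (suc m)) → Σ Part (λ s → T (C.inCopy s (proj₁ w)))
  whichPart ((i , j) , t) with T-∨-elim (inG m (i , j)) t
  ... | inj₁ tL = lowerLeft , tL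
  ... | inj₂ t′ with T-∨-elim (inLowerRight m (i , j)) t′
  ... | inj₁ tR = lowerRight , tR
  ... | inj₂ tU = upper , tU

  uVec : Part → Vtx (suc m) → ℤ
  uVec upper      = u↑ m
  uVec lowerLeft  = u← m
  uVec lowerRight = u→ m

  gens : List (Vtx (suc m) → ℤ)
  gens = uVec upper ∷ uVec lowerLeft ∷ uVec lowerRight ∷ δ (suc m) (aJ m) ∷ δ (suc m) (bJ m) ∷ δ (suc m) (cJ m) ∷ []

  H : (Vtx (suc m) → ℤ) → Set
  H = InH (suc m) gens

  uVec∈gens : ∀ s → uVec s ∈ gens
  uVec∈gens upper      = here refl
  uVec∈gens lowerLeft  = there (here refl)
  uVec∈gens lowerRight = there (there (here refl))

  junctions : List Pt
  junctions = aJ m ∷ bJ m ∷ cJ m ∷ []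

  junctions-δ∈ : All (λ p → δ (suc m) p ∈ gens) junctions
  junctions-δ∈ = there (there (there (here refl)))
               ∷ there (there (there (there (here refl))))
               ∷ there (there (there (there (there (here refl))))) ∷ []

  isJunction⇒∈junctions : ∀ p → T (isJunction m p) → p ∈ junctions
  isJunction⇒∈junctions p tJ with isJunction⇒ m p tJ
  ... | inj₁ e        = here e
  ... | inj₂ (inj₁ e) = there (here e)
  ... | inj₂ (inj₂ e) = there (there (here e))

  H-agreeOffJunctions : ∀ {f g} → (∀ w → f w ≡ g w ⊎ T (isJunction m (proj₁ w))) → H g → H f
  H-agreeOffJunctions agree = InH-agreeOff junctions junctions-δ∈ λ w → map₂ (isJunction⇒∈junctions (proj₁ w)) (agree w)

  H-supportedOnJunctions : ∀ {f} → (∀ w → f w ≡ + 0 ⊎ T (isJunction m (proj₁ w))) → H f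
  H-supportedOnJunctions supp = H-agreeOffJunctions supp zro

  H-cancelʳ : ∀ {f g} → H (f ⊕ g) → H g → H f
  H-cancelʳ {f} {g} hfg hg = resp (λ w → solve 2 (λ a b → a :+ b :+ (:- b) := a) refl (f w) (g w)) (add hfg (neg hg))

  uVec-outside : ∀ s w → C.inCopy s (proj₁ w) ≡ false → uVec s w ≡ + 0
  uVec-outside upper      = UVectors.u↑-outside m
  uVec-outside lowerLeft  = UVectors.u←-outside m
  uVec-outside lowerRight = UVectors.u→-outside m

  uVec-embed : ∀ s v → isJunction m (C.embPt s (proj₁ v)) ≡ false → uVec s (C.embed s v) ≡ - Δ m (δ m (C.κ₁ s)) v
  uVec-embed upper      = UVectors.u↑-embed m
  uVec-embed lowerLeft  = UVectors.u←-embed m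
  uVec-embed lowerRight = UVectors.u→-embed m

  module UV (s : Part) = C.UVector s (uVec s) (C.κ₁ s) (uVec-outside s) (uVec-embed s)

  H-uVec∘embed : ∀ s s′ → C.H s′ (uVec s ∘ C.embed s′)
  H-uVec∘embed s s′ with s ≟ₚ s′
  ... | yes refl = UV.H-u∘embed s
  ... | no s≢s′  = Other.H-outside∘embed s s′ s≢s′ (uVec s) (uVec-outside s)

  H-δJunction∘embed : ∀ s J → T (isJunction m J) → C.H s (δ (suc m) J ∘ C.embed s)
  H-δJunction∘embed s J tJ = C.H-supportedOnCorners s λ v → byPoint v (C.embPt s (proj₁ v) ≟ᵖ J)
    where
    byPoint : ∀ v → Dec (C.embPt s (proj₁ v) ≡ J) →
              δ (suc m) J (C.embed s v) ≡ + 0 ⊎ T (isJunction m (C.embPt s (proj₁ v)))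
    byPoint v (yes e)   = inj₂ (subst (T ∘ isJunction m) (sym e) tJ)
    byPoint v (no ¬e)   = inj₁ (cong indicator (≢⇒==ᵖ-false _ _ ¬e))

  restrict-H : ∀ s {f} → H f → C.H s (f ∘ C.embed s)
  restrict-H s (lap c)                                                      = C.H-Δ∘embed s c
  restrict-H s (gen (here refl))                                            = H-uVec∘embed upper s
  restrict-H s (gen (there (here refl)))                                    = H-uVec∘embed lowerLeft s
  restrict-H s (gen (there (there (here refl))))                            = H-uVec∘embed lowerRight s
  restrict-H s (gen (there (there (there (here refl)))))                    = H-δJunction∘embed s (aJ m) (isJunction-a m refl)
  restrict-H s (gen (there (there (there (there (here refl))))))            = H-δJunction∘embed s (bJ m) (isJunction-b m refl)
  restrict-H s (gen (there (there (there (there (there (here refl)))))))    = H-δJunction∘embed s (cJ m) (isJunction-c m refl)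
  restrict-H s zro        = zro
  restrict-H s (add h h′) = add (restrict-H s h) (restrict-H s h′)
  restrict-H s (neg h)    = neg (restrict-H s h)
  restrict-H s (resp e h) = resp (λ v → e (C.embed s v)) (restrict-H s h)

  glueAll : (Part → Vtx m → ℤ) → Vtx (suc m) → ℤ
  glueAll t w = C.glue upper (t upper) w ℤ.+ (C.glue lowerLeft (t lowerLeft) w ℤ.+ C.glue lowerRight (t lowerRight) w)

  glueAll-vanishing : ∀ s t w → (∀ r → ¬ r ≡ s → C.glue r (t r) w ≡ + 0) → glueAll t w ≡ C.glue s (t s) w
  glueAll-vanishing upper t w vanish =
    trans (cong (λ x → C.glue upper (t upper) w ℤ.+ x) (cong₂ ℤ._+_ (vanish lowerLeft λ ()) (vanish lowerRight λ ())))
          (ℤP.+-identityʳ _)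
  glueAll-vanishing lowerLeft t w vanish =
    trans (cong₂ ℤ._+_ (vanish upper λ ()) (cong (λ x → C.glue lowerLeft (t lowerLeft) w ℤ.+ x) (vanish lowerRight λ ())))
          (trans (ℤP.+-identityˡ _) (ℤP.+-identityʳ _))
  glueAll-vanishing lowerRight t w vanish =
    trans (cong₂ ℤ._+_ (vanish upper λ ()) (cong (λ x → x ℤ.+ C.glue lowerRight (t lowerRight) w) (vanish lowerLeft λ ())))
          (trans (ℤP.+-identityˡ _) (ℤP.+-identityˡ _))

  glueAll-pair : ∀ s t w → C.glue (third s) (t (third s)) w ≡ + 0 →
                 glueAll t w ≡ C.glue s (t s) w ℤ.+ C.glue (next s) (t (next s)) w
  glueAll-pair upper t w third≡0 =
    cong (λ x → gU ℤ.+ x) (trans (cong (ℤ._+ gR) third≡0) (ℤP.+-identityˡ gR))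
    where gU = C.glue upper (t upper) w; gR = C.glue lowerRight (t lowerRight) w
  glueAll-pair lowerLeft t w third≡0 =
    trans (cong (λ x → gU ℤ.+ x) (trans (cong (λ x → gL ℤ.+ x) third≡0) (ℤP.+-identityʳ gL))) (ℤP.+-comm gU gL)
    where gU = C.glue upper (t upper) w; gL = C.glue lowerLeft (t lowerLeft) w
  glueAll-pair lowerRight t w third≡0 =
    trans (cong (ℤ._+ (gL ℤ.+ gR)) third≡0) (trans (ℤP.+-identityˡ (gL ℤ.+ gR)) (ℤP.+-comm gL gR))
    where gL = C.glue lowerLeft (t lowerLeft) w; gR = C.glue lowerRight (t lowerRight) w

  glueAll-inCopy : ∀ s t w (tC : T (C.inCopy s (proj₁ w))) → isJunction m (proj₁ w) ≡ false →
                   glueAll t w ≡ t s (C.unembed s w tC)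
  glueAll-inCopy s t w tC ¬J =
    trans (glueAll-vanishing s t w (λ r r≢s → Other.glue-inOther r s r≢s (t r) w tC ¬J)) (C.glue-inCopy s (t s) w tC ¬J)

  glueAll-agree : ∀ (f : Vtx (suc m) → ℤ) t → (∀ s w tC → isJunction m (proj₁ w) ≡ false → f w ≡ t s (C.unembed s w tC)) →
                  ∀ w → glueAll t w ≡ f w ⊎ T (isJunction m (proj₁ w))
  glueAll-agree f t agree w = caseJunction m (proj₁ w) λ ¬J →
    let (s , tC) = whichPart w in trans (glueAll-inCopy s t w tC ¬J) (sym (agree s w tC ¬J))

  glueAll-embed : ∀ s t v → glueAll t (C.embed s v) ≡ t s v ⊎ proj₁ v ∈ C.corners s
  glueAll-embed s t v = C.caseCorner s v λ ¬J →
    trans (glueAll-inCopy s t (C.embed s v) (C.inCopy-embPt s _ (proj₂ v)) ¬J) (cong-vtx {m} (t s) (C.unembPt-embPt s (proj₁ v)))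

  restrictAll : (Vtx (suc m) → ℤ) → Part → Vtx m → ℤ
  restrictAll f s = f ∘ C.embed s

  H-glueAll-restrict⇒H : ∀ d → H (glueAll (restrictAll d)) → H d
  H-glueAll-restrict⇒H d = H-agreeOffJunctions λ w → map₁ sym (glueAll-agree d (restrictAll d)
    (λ s w tC _ → cong-vtx {suc m} d (sym (C.embPt-unembPt s _ tC))) w)

  H-glueAllΔ : ∀ F → H (Δ (suc m) F) → H (glueAll (λ s → Δ m (restrictAll F s)))
  H-glueAllΔ F = H-agreeOffJunctions (glueAll-agree (Δ (suc m) F) (λ s → Δ m (restrictAll F s)) λ s → C.Δ-inCopy s F)

  GluesΔ : Part → (Vtx m → ℤ) → Set
  GluesΔ s c = H (C.glue s (Δ m c))

  module _ (s : Part) where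

    GluesΔ-resp : ∀ {c c′} → (∀ v → c v ≡ c′ v) → GluesΔ s c′ → GluesΔ s c
    GluesΔ-resp c≗c′ = resp (C.glue-cong s (Δ-cong m (sym ∘ c≗c′)))

    GluesΔ-⊕ : ∀ {f g} → GluesΔ s f → GluesΔ s g → GluesΔ s (f ⊕ g)
    GluesΔ-⊕ {f} {g} hf hg = resp (λ w → sym (trans (C.glue-cong s (Δ-⊕ m f g) w) (C.glue-⊕ s _ _ w))) (add hf hg)

    GluesΔ-* : ∀ {f} → GluesΔ s f → ∀ k → GluesΔ s (λ v → k ℤ.* f v)
    GluesΔ-* {f} hf k = resp (λ w → sym (trans (C.glue-cong s (Δ-* m k f) w) (C.glue-map s (Δ m f) (k ℤ.*_) (ℤP.*-zeroʳ k) w)))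
                             (InH-* hf k)

    GluesΔ-offCorners : ∀ c → (∀ (v : Vtx m) → proj₁ v ∈ C.corners s → c v ≡ + 0) → GluesΔ s c
    GluesΔ-offCorners c c≗0 = resp
      (λ w → trans (glueAll-vanishing s _ w (vanish w)) (C.glue-cong s (Δ-cong m (C.glue-embed-offCorners s c c≗0)) w))
      (H-glueAllΔ (C.glue s c) (lap (C.glue s c)))
      where
      vanish : ∀ w r → ¬ r ≡ s → C.glue r (Δ m (restrictAll (C.glue s c) r)) w ≡ + 0
      vanish w r r≢s = trans (C.glue-cong r (Δ-0 m (Other.glue-embedOther s r (r≢s ∘ sym) c)) w) (C.glue-0 r w)

    -- c = c κ₁ · δ κ₁ + c κ₂ · δ κ₂ + (c with its corner values erased).
    GluesΔ-all : GluesΔ s (δ m (C.κ₁ s)) → GluesΔ s (δ m (C.κ₂ s)) → ∀ c → GluesΔ s c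
    GluesΔ-all hκ₁ hκ₂ c = GluesΔ-resp split
      (GluesΔ-⊕ {f₁} {f₂ ⊕ c₀} (GluesΔ-* hκ₁ k₁)
        (GluesΔ-⊕ {f₂} {c₀} (GluesΔ-* hκ₂ k₂) (GluesΔ-offCorners c₀ c₀-corners)))
      where
      κ₁ = C.κ₁ s
      κ₂ = C.κ₂ s
      k₁ = extend m c κ₁
      k₂ = extend m c κ₂
      f₁ f₂ c₀ : Vtx m → ℤ
      f₁ v = k₁ ℤ.* δ m κ₁ v
      f₂ v = k₂ ℤ.* δ m κ₂ v
      c₀ v = if (proj₁ v ==ᵖ κ₁) ∨ (proj₁ v ==ᵖ κ₂) then + 0 else c v
      split : ∀ v → c v ≡ k₁ ℤ.* δ m κ₁ v ℤ.+ (k₂ ℤ.* δ m κ₂ v ℤ.+ c₀ v)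
      split v = split-by-indicators (proj₁ v ==ᵖ κ₁) (proj₁ v ==ᵖ κ₂) (c v) k₁ k₂ (value-at κ₁) (value-at κ₂)
                  (λ t → ≢⇒==ᵖ-false _ κ₂ λ e → C.κ₁≢κ₂ s (trans (sym (==ᵖ⇒≡ _ κ₁ t)) e))
        where
        value-at : ∀ κ → T (proj₁ v ==ᵖ κ) → extend m c κ ≡ c v
        value-at κ t = trans (cong (extend m c) (sym (==ᵖ⇒≡ _ κ t))) (extend-vtx m c v)
      c₀-corners : ∀ (v : Vtx m) → proj₁ v ∈ C.corners s → c₀ v ≡ + 0
      c₀-corners v (here e)         rewrite T⇒true (≡⇒==ᵖ e) = refl
      c₀-corners v (there (here e)) rewrite T⇒true (≡⇒==ᵖ e) | BP.∨-zeroʳ (proj₁ v ==ᵖ κ₁) = refl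

  GluesΔ-κ₁ : ∀ s → GluesΔ s (δ m (C.κ₁ s))
  GluesΔ-κ₁ s = H-agreeOffJunctions (UV.glue-Δδ s) (neg (gen (uVec∈gens s)))

  junction-shared : ∀ s → C.embPt s (C.κ₂ s) ≡ C.embPt (next s) (C.κ₁ (next s))
  junction-shared upper      = cong₂ _,_ (ℕP.+-identityʳ N) (sym (ℕP.+-identityʳ N))
  junction-shared lowerLeft  = refl
  junction-shared lowerRight = refl

  junction-∉third : ∀ s → ¬ T (C.inCopy (third s) (C.embPt s (C.κ₂ s)))
  junction-∉third upper      = UVectors.bJ∉G m ∘ subst (T ∘ inG m) (cong (_, N) (ℕP.+-identityʳ N))
  junction-∉third lowerLeft  = false⇒¬T (cong (_∧ inG m (0 ∸ N , N)) (2^m≤ᵇ0≡false m))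
  junction-∉third lowerRight = false⇒¬T (cong (_∧ inG m (N , 0 ∸ N)) (2^m≤ᵇ0≡false m))

  -- Δ δ_J restricts to Δ δ_κ on each of the two copies meeting at the junction J.
  H-glueΔδ-junction : ∀ s → H (C.glue s (Δ m (δ m (C.κ₂ s))) ⊕ C.glue (next s) (Δ m (δ m (C.κ₁ (next s)))))
  H-glueΔδ-junction s = resp pointwise (H-glueAllΔ (δ (suc m) J) (lap (δ (suc m) J)))
    where
    J = C.embPt s (C.κ₂ s)
    t : Part → Vtx m → ℤ
    t r = Δ m (restrictAll (δ (suc m) J) r)
    own-next : ∀ v → δ (suc m) J (C.embed (next s) v) ≡ δ m (C.κ₁ (next s)) v
    own-next v = trans (cong (λ p → δ (suc m) p (C.embed (next s) v)) (junction-shared s)) (C.δ-embed (next s) (C.κ₁ (next s)) v)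
    pointwise : ∀ w → glueAll t w ≡ C.glue s (Δ m (δ m (C.κ₂ s))) w ℤ.+ C.glue (next s) (Δ m (δ m (C.κ₁ (next s)))) w
    pointwise w = trans (glueAll-pair s t w third≡0)
      (cong₂ ℤ._+_ (C.glue-cong s (Δ-cong m (C.δ-embed s (C.κ₂ s))) w) (C.glue-cong (next s) (Δ-cong m own-next) w))
      where
      third≡0 = trans (C.glue-cong (third s) (Δ-0 m (C.δ-embed-outside (third s) J (junction-∉third s))) w) (C.glue-0 (third s) w)

  GluesΔ-κ₂ : ∀ s → GluesΔ s (δ m (C.κ₂ s))
  GluesΔ-κ₂ s = H-cancelʳ (H-glueΔδ-junction s) (GluesΔ-κ₁ (next s))

  glue-H : ∀ s {t} → C.H s t → H (C.glue s t)
  glue-H s (lap c)                    = GluesΔ-all s (GluesΔ-κ₁ s) (GluesΔ-κ₂ s) c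
  glue-H s (gen (here refl))          = H-supportedOnJunctions (C.glue-δκ s (C.κ₁ s) (C.κ₁-isJunction s))
  glue-H s (gen (there (here refl)))  = H-supportedOnJunctions (C.glue-δκ s (C.κ₂ s) (C.κ₂-isJunction s))
  glue-H s (gen (there (there ())))
  glue-H s zro                        = H-supportedOnJunctions (λ w → inj₁ (C.glue-0 s w))
  glue-H s (add {f} {g} h h′)         = resp (λ w → sym (C.glue-⊕ s f g w)) (add (glue-H s h) (glue-H s h′))
  glue-H s (neg {f} h)                = resp (λ w → sym (C.glue-map s f -_ refl w)) (neg (glue-H s h))
  glue-H s (resp e h)                 = resp (C.glue-cong s e) (glue-H s h)

  restrictAll-glueAll : ∀ s t → QRel m (C.cornerGens s) (restrictAll (glueAll t) s) (t s)
  restrictAll-glueAll s t = qrel (InH-supportedOn (C.corners s) (C.corners-δ∈ s) λ v →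
    map₁ (λ e → trans (cong (_- t s v) e) (ℤP.+-inverseʳ (t s v))) (glueAll-embed s t v))


theorem2 : (m : ℕ) →
    Σ (AbelianGroup.Carrier (ΓQ m) →
       AbelianGroup.Carrier (abelianGroup (Γ↑ m) (abelianGroup (Γ← m) (Γ→ m))))
      (GroupMorphisms.IsGroupIsomorphism
        (AbelianGroup.rawGroup (ΓQ m))
        (AbelianGroup.rawGroup (abelianGroup (Γ↑ m) (abelianGroup (Γ← m) (Γ→ m)))))
theorem2 m = φ , record
  { isGroupMonomorphism = record
    { isGroupHomomorphism = record
      { isMonoidHomomorphism = record
        { isMagmaHomomorphism = record { isRelHomomorphism = record { cong = φ-cong } ; homo = λ _ _ → G.refl }
        ; ε-homo = G.refl }
      ; ⁻¹-homo = λ _ → G.refl }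
    ; injective = φ-injective }
  ; surjective = φ-surjective }
  where
  open Decomposition m
  module G = AbelianGroup (abelianGroup (Γ↑ m) (abelianGroup (Γ← m) (Γ→ m)))
  module Q = AbelianGroup (ΓQ m)

  φ : Q.Carrier → G.Carrier
  φ x = restrictAll x upper , restrictAll x lowerLeft , restrictAll x lowerRight

  φ-cong : ∀ {x y} → x Q.≈ y → φ x G.≈ φ y
  φ-cong (qrel h) = qrel (restrict-H upper h) , qrel (restrict-H lowerLeft h) , qrel (restrict-H lowerRight h)

  φ-injective : ∀ {x y} → φ x G.≈ φ y → x Q.≈ y
  φ-injective (qrel hU , qrel hL , qrel hR) =
    qrel (H-glueAll-restrict⇒H _ (add (glue-H upper hU) (add (glue-H lowerLeft hL) (glue-H lowerRight hR))))

  φ-surjective : ∀ y → Σ Q.Carrier (λ x → ∀ {z} → z Q.≈ x → φ z G.≈ y)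
  φ-surjective (a , b , c) = glueAll t , λ z≈ → G.trans (φ-cong z≈)
      (restrictAll-glueAll upper t , restrictAll-glueAll lowerLeft t , restrictAll-glueAll lowerRight t)
    where
    t : Part → Vtx m → ℤ
    t upper      = a
    t lowerLeft  = b
    t lowerRight = c
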